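{- Let $\ell\ge2$ and let $(b|g;f_1,\dots,f_\ell)$ and $(c|d;p_1,\dots,p_\ell)$ be two multiple almost-Riordan arrays, where $b=\sum_{k\ge0}b_{\ell k}t^{\ell k}$, $c=\sum_{k\ge0}c_{\ell k}t^{\ell k}$. Let $h=\sqrt[\ell]{f_1f_2\cdots f_\ell}$ and let $\overline h$ be its compositional inverse. Then, with ordinary matrix multiplication, $$(b|g;f_1,\dots,f_\ell)(c|d;p_1,\dots,p_\ell)=\Bigl(c_0b+\frac{tg}{f_\ell}\bigl(c(h)-c_0\bigr)\ \Big|\ g\,d(h);\ \frac{f_1}{h}p_1(h),\ \frac{f_2}{h}p_2(h),\dots,\frac{f_\ell}{h}p_\ell(h)\Bigr),$$ and $$(b|g;f_1,\dots,f_\ell)^{ -1}=\Bigl(\frac1{b_0}+\frac{f_\ell(\overline h)}{b_0\,\overline h\,g(\overline h)}\bigl(b_0-b(\overline h)\bigr)\ \Big|\ \frac1{g(\overline h)};\ \frac{t\,\overline h}{f_1(\overline h)},\ \frac{t\,\overline h}{f_2(\overline h)},\dots,\frac{t\,\overline h}{f_\ell(\overline h)}\Bigr).$$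
   Context: Fix an integer $\ell\ge2$ and a field $\mathbb K$ of characteristic $0$; $\mathbb K[[t^\ell]]$ denotes the formal power series in $t^\ell$ and $t\mathbb K[[t^\ell]]=\{t\,w:w\in\mathbb K[[t^\ell]]\}$. Let $b,g\in\mathbb K[[t^\ell]]$ with $b_0:=b(0)\ne0$, $g(0)\ne0$, and $f_1,\dots,f_\ell\in t\mathbb K[[t^\ell]]$ with nonzero coefficient of $t$. The multiple almost-Riordan array $(b|g;f_1,\dots,f_\ell)$ is the infinite lower triangular matrix $(d_{n,k})_{n,k\ge0}$ with $d_{n,0}=[t^n]b(t)$ and, for $k\ge1$, $d_{n,k}=[t^n]\,t\,g\,f_1^{e_1(k)}\cdots f_\ell^{e_\ell(k)}$ with $e_i(k)=\lfloor (k-1+\ell-i)/\ell\rfloor$; i.e. its columns have generating functions $b, tg, tgf_1, tgf_1f_2,\dots,tgf_1\cdots f_\ell, tgf_1^2f_2\cdots f_\ell,\dots$. The same definition applies to $(c|d;p_1,\dots,p_\ell)$ with $c,d\in\mathbb K[[t^\ell]]$, $c(0),d(0)\ne0$, $p_j\in t\mathbb K[[t^\ell]]$ with nonzero coefficient of $t$. $h\in t\mathbb K[[t]]$ denotes a formal power series with $h^\ell=f_1\cdots f_\ell$ (assumed to exist, e.g. when $\mathbb K$ is algebraically closed), $\overline h$ its compositional inverse ($h(\overline h(t))=\overline h(h(t))=t$), and expressions like $c(h)$, $p_j(h)$, $f_j(\overline h)$ denote composition. -}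

module Defs where

open import Level using (_⊔_)
open import Data.Nat as ℕ using (ℕ; zero; suc; _∸_; _≤_)
open import Data.Nat.DivMod using (_/_)
open import Data.Nat.Divisibility using (_∣_)
open import Data.Fin using (Fin; toℕ)
import Data.Fin as Fin
open import Data.Product using (_×_)
open import Relation.Nullary using (¬_)
open import Algebra.Bundles using (CommutativeRing)

record Field (a r : Level.Level) : Set (Level.suc (a ⊔ r)) where
  field
    commutativeRing : CommutativeRing a r
  open CommutativeRing commutativeRing public
  field
    _⁻¹      : Carrier → Carrier
    ⁻¹-inverse : ∀ x → ¬ (x ≈ 0#) → (x * (x ⁻¹)) ≈ 1#
    0≉1      : ¬ (0# ≈ 1#)

module FPS {a r} (K : Field a r) where
  open Field K public

  ι : ℕ → Carrier
  ι zero    = 0#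
  ι (suc n) = 1# + ι n

  CharZero : Set r
  CharZero = ∀ n → ¬ (ι (suc n) ≈ 0#)

  Series : Set a
  Series = ℕ → Carrier

  infix 4 _≋_
  _≋_ : Series → Series → Set r
  A ≋ B = ∀ n → A n ≈ B n

  Σ≤ : ℕ → (ℕ → Carrier) → Carrier
  Σ≤ zero    u = u 0
  Σ≤ (suc n) u = Σ≤ n u + u (suc n)

  const : Carrier → Series
  const x zero    = x
  const x (suc n) = 0#

  X : Series
  X 0 = 0#
  X 1 = 1#
  X (suc (suc n)) = 0#

  infixl 6 _⊕_ _⊖_
  infixl 7 _⊛_ _•_
  _⊕_ : Series → Series → Series
  (A ⊕ B) n = A n + B n

  _⊖_ : Series → Series → Series
  (A ⊖ B) n = A n + - (B n)

  _•_ : Carrier → Series → Series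
  (x • A) n = x * A n

  _⊛_ : Series → Series → Series
  (A ⊛ B) n = Σ≤ n (λ i → A i * B (n ∸ i))

  pow : Series → ℕ → Series
  pow A zero    = const 1#
  pow A (suc k) = A ⊛ pow A k

  -- composition A(H); meaningful when H 0 ≈ 0 (then only k ≤ n contribute)
  _∘ₛ_ : Series → Series → Series
  (A ∘ₛ H) n = Σ≤ n (λ k → A k * pow H k n)

  -- multiplicative inverse 1/A of a series with A 0 ≉ 0:
  -- 1/A = A₀⁻¹ · 1/(1 - U) with U = 1 - A₀⁻¹ A (U 0 = 0), 1/(1-U) = Σ_k U^k
  geom : Series
  geom _ = 1#

  inv : Series → Series
  inv A = (A 0 ⁻¹) • (geom ∘ₛ (const 1# ⊖ (A 0 ⁻¹) • A))

  -- A / C for C 0 ≉ 0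
  _÷_ : Series → Series → Series
  A ÷ C = A ⊛ inv C

  -- division by t of a series with zero constant term
  shift : Series → Series
  shift A n = A (suc n)

  -- A / C for A, C ∈ tK[[t]] with C 1 ≉ 0  (i.e. (A/t)/(C/t))
  _÷ₜ_ : Series → Series → Series
  A ÷ₜ C = shift A ÷ shift C

  Π : (n : ℕ) → (Fin n → Series) → Series
  Π zero    F = const 1#
  Π (suc n) F = F Fin.zero ⊛ Π n (λ i → F (Fin.suc i))

  InPowℓ : ℕ → Series → Set r
  InPowℓ ℓ A = ∀ n → ¬ (ℓ ∣ n) → A n ≈ 0#

  InTPowℓ : ℕ → Series → Set r
  InTPowℓ ℓ A = (A 0 ≈ 0#) × (∀ n → ¬ (ℓ ∣ n) → A (suc n) ≈ 0#)

  Matrix : Set a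
  Matrix = ℕ → ℕ → Carrier

  infix 4 _≋ᴹ_
  _≋ᴹ_ : Matrix → Matrix → Set r
  M ≋ᴹ N = ∀ n k → M n k ≈ N n k

  -- product of lower-triangular matrices: (MN)_{n,k} = Σ_{j=0}^{n} M_{n,j} N_{j,k}
  -- (the remaining terms j > n vanish since M is lower triangular)
  infixl 7 _⊗_
  _⊗_ : Matrix → Matrix → Matrix
  (M ⊗ N) n k = Σ≤ n (λ j → M n j * N j k)

  Id : Matrix
  Id zero    zero    = 1#
  Id zero    (suc k) = 0#
  Id (suc n) zero    = 0#
  Id (suc n) (suc k) = Id n k

  -- Multiple almost-Riordan array (B | G ; F₁,…,F_ℓ), ℓ = 2 + m.
  -- Fin index i : Fin ℓ stands for the paper's index i+1.
  -- Column 0 : B;  column k ≥ 1 : t G Π_i F_i^{e_i(k)},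
  -- e_{i+1}(k) = ⌊(k - 1 + ℓ - (i+1)) / ℓ⌋.

  expo : (m : ℕ) → ℕ → Fin (suc (suc m)) → ℕ
  expo m k i = ((k ∸ 1) ℕ.+ (suc (suc m) ∸ suc (toℕ i))) / (suc (suc m))

  column : (m : ℕ) → Series → Series → (Fin (suc (suc m)) → Series) → ℕ → Series
  column m B G F zero    = B
  column m B G F (suc k) =
    X ⊛ G ⊛ Π (suc (suc m)) (λ i → pow (F i) (expo m (suc k) i))

  MAR : (m : ℕ) → Series → Series → (Fin (suc (suc m)) → Series) → Matrix
  MAR m B G F n k = column m B G F k n

-- Since h^ℓ = f₁⋯f_ℓ, column qℓ + r + 1 of (b|g;f₁,…,f_ℓ) equals h^(qℓ+r+1)·W_r with
-- W_r = g·(f₁/h)⋯(f_r/h)·(t/h). On the columns j ≡ r + 1 (mod ℓ) the array therefore acts like the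
-- Riordan array (W_r, h), sending a vector a supported there to a(h)·W_r. Column k + 1 of (c|d;p₁,…,p_ℓ)
-- is supported on the degrees j ≡ k + 1 (mod ℓ), which yields column k + 1 of the product; column 0
-- follows by splitting c = c₀ + (c − c₀). In characteristic 0 the ℓ-th root h of f₁⋯f_ℓ ∈ t^ℓK[[t^ℓ]]
-- lies in tK[[t^ℓ]], and then so does h̄, which keeps every series in its residue class. The inverse is
-- checked by applying the product rule on both sides and simplifying with h(h̄) = h̄(h) = t.

module Submission where

open import Defs
open import Level using (Level)
open import Data.Nat as ℕ using (ℕ; zero; suc; _∸_; _≤_; _<_; z≤n; s≤s)
open import Data.Nat.Properties as ℕ using (≤-refl; <⇒≤; m≤n⇒m≤1+n; m∸n≤m; m∸[m∸n]≡n; m≤n⇒m<n∨m≡n; <-≤-trans)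
open import Data.Nat.DivMod
  using ( _%_; _/_; m≡m%n+[m/n]*n; +-distrib-/-∣ʳ; m*n/n≡m; m<n⇒m/n≡0; m≥n⇒m/n>0; m<n*o⇒m/o<n; m%n<n
        ; %-distribˡ-+; [m+n]%n≡m%n; m*n%n≡0; m<n⇒m%n≡m)
open import Data.Nat.Divisibility using (_∣_; n∣m*n; n∣m⇒m%n≡0)
open import Data.Nat.Induction using (<-rec)
open import Data.Fin as Fin using (Fin; toℕ; fromℕ)
open import Data.Fin.Properties using (toℕ<n)
open import Data.Vec.Functional using (Vector)
open import Algebra.Properties.CommutativeMonoid.Sum ℕ.+-0-commutativeMonoid using (sum; ∑-distrib-+; sum-cong-≗; sum-replicate-zero)
open import Data.Product using (_×_; _,_)
open import Data.Sum using (_⊎_; inj₁; inj₂)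
open import Relation.Nullary using (¬_; Dec; yes; no; contradiction)
import Relation.Nullary.Decidable as Dec
open import Relation.Binary.Bundles using (Setoid)
open import Relation.Binary.PropositionalEquality as ≡ using (_≡_)
open import Algebra.Bundles using (CommutativeRing)
import Algebra.Properties.Ring as RingProperties
import Algebra.Solver.Ring.NaturalCoefficients.Default as Solver
import Relation.Binary.Reasoning.Setoid as SetoidReasoning

module Exponents where
  open import Data.Nat using (_+_; _*_)
  open import Data.Nat.Properties using (≮⇒≥; m+[n∸m]≡n; +-monoˡ-≤; +-monoˡ-<; +-mono-<-≤; +-identityʳ; +-assoc; +-comm; *-comm)
  open ≡ using (refl; cong; cong₂)

  χ< : ∀ {n} → ℕ → Vector ℕ n
  χ< zero    i           = 0
  χ< (suc r) Fin.zero    = 1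
  χ< (suc r) (Fin.suc i) = χ< r i

  χ<-< : ∀ {n} r (i : Fin n) → toℕ i < r → χ< r i ≡ 1
  χ<-< (suc r) Fin.zero    _         = refl
  χ<-< (suc r) (Fin.suc i) (s≤s i<r) = χ<-< r i i<r

  χ<-≥ : ∀ {n} r (i : Fin n) → r ≤ toℕ i → χ< r i ≡ 0
  χ<-≥ zero    i           _         = refl
  χ<-≥ (suc r) (Fin.suc i) (s≤s r≤i) = χ<-≥ r i r≤i

  sum-const : ∀ n q → sum {n} (λ _ → q) ≡ n * q
  sum-const zero    q = refl
  sum-const (suc n) q = cong (q +_) (sum-const n q)

  sum-χ< : ∀ {n} r → r ≤ n → sum {n} (χ< r) ≡ r
  sum-χ< {n}     zero    _         = sum-replicate-zero n
  sum-χ< {suc n} (suc r) (s≤s r≤n) = cong suc (sum-χ< r r≤n)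

  -- (k + (ℓ ∸ suc (toℕ i))) / ℓ below is expo m (suc k) i, the paper's e_{i+1}(k + 1).
  module ColumnExponents (m : ℕ) where

    ℓ : ℕ
    ℓ = suc (suc m)

    private
      0<x<2⇒x≡1 : ∀ {x} → 0 < x → x < 2 → x ≡ 1
      0<x<2⇒x≡1 {suc zero}    _ _                 = refl
      0<x<2⇒x≡1 {suc (suc x)} _ (s≤s (s≤s ()))

    expo-residue : ∀ r (i : Fin ℓ) → r < ℓ → (r + (ℓ ∸ suc (toℕ i))) / ℓ ≡ χ< r i
    expo-residue r i r<ℓ with toℕ i ℕ.<? r
    ... | yes i<r = ≡.trans (0<x<2⇒x≡1 (m≥n⇒m/n>0 ℓ≤x) (m<n*o⇒m/o<n x<2ℓ)) (≡.sym (χ<-< r i i<r))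
      where
      ℓ≤x : ℓ ≤ r + (ℓ ∸ suc (toℕ i))
      ℓ≤x = ≡.subst (_≤ r + (ℓ ∸ suc (toℕ i))) (m+[n∸m]≡n (toℕ<n i)) (+-monoˡ-≤ (ℓ ∸ suc (toℕ i)) i<r)
      x<2ℓ : r + (ℓ ∸ suc (toℕ i)) < 2 * ℓ
      x<2ℓ = ≡.subst (r + (ℓ ∸ suc (toℕ i)) <_) (cong (ℓ +_) (≡.sym (+-identityʳ ℓ)))
          (+-mono-<-≤ r<ℓ (m∸n≤m ℓ (suc (toℕ i))))
    ... | no i≮r = ≡.trans (m<n⇒m/n≡0 x<ℓ) (≡.sym (χ<-≥ r i (≮⇒≥ i≮r)))
      where
      x<ℓ : r + (ℓ ∸ suc (toℕ i)) < ℓ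
      x<ℓ = ≡.subst (r + (ℓ ∸ suc (toℕ i)) <_) (m+[n∸m]≡n (toℕ<n i)) (+-monoˡ-< (ℓ ∸ suc (toℕ i)) (s≤s (≮⇒≥ i≮r)))

    expo-suc : ∀ k (i : Fin ℓ) → (k + (ℓ ∸ suc (toℕ i))) / ℓ ≡ χ< (k % ℓ) i + k / ℓ
    expo-suc k i = begin
      (k + t) / ℓ                      ≡⟨ cong (λ z → (z + t) / ℓ) (m≡m%n+[m/n]*n k ℓ) ⟩
      (k % ℓ + k / ℓ * ℓ + t) / ℓ      ≡⟨ cong (_/ ℓ) (+-comm-middle (k % ℓ) (k / ℓ * ℓ) t) ⟩
      (k % ℓ + t + k / ℓ * ℓ) / ℓ      ≡⟨ +-distrib-/-∣ʳ (k % ℓ + t) (n∣m*n (k / ℓ)) ⟩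
      (k % ℓ + t) / ℓ + k / ℓ * ℓ / ℓ  ≡⟨ cong₂ _+_ (expo-residue (k % ℓ) i (m%n<n k ℓ)) (m*n/n≡m (k / ℓ) ℓ) ⟩
      χ< (k % ℓ) i + k / ℓ             ∎
      where
      open ≡.≡-Reasoning
      t : ℕ
      t = ℓ ∸ suc (toℕ i)
      +-comm-middle : ∀ a b c → a + b + c ≡ a + c + b
      +-comm-middle a b c = ≡.trans (+-assoc a b c) (≡.trans (cong (a +_) (+-comm b c)) (≡.sym (+-assoc a c b)))

    k≡k%ℓ+ℓ*[k/ℓ] : ∀ k → k ≡ k % ℓ + ℓ * (k / ℓ)
    k≡k%ℓ+ℓ*[k/ℓ] k = ≡.trans (m≡m%n+[m/n]*n k ℓ) (cong (k % ℓ +_) (*-comm (k / ℓ) ℓ))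

    sum-expo-suc : ∀ k → sum {ℓ} (λ i → (k + (ℓ ∸ suc (toℕ i))) / ℓ) ≡ k
    sum-expo-suc k = begin
      sum {ℓ} (λ i → (k + (ℓ ∸ suc (toℕ i))) / ℓ)
        ≡⟨ sum-cong-≗ {ℓ} (expo-suc k) ⟩
      sum {ℓ} (λ i → χ< (k % ℓ) i + k / ℓ)
        ≡⟨ ∑-distrib-+ (χ< (k % ℓ)) (λ _ → k / ℓ) ⟩
      sum {ℓ} (χ< (k % ℓ)) + sum {ℓ} (λ _ → k / ℓ)
        ≡⟨ cong₂ _+_ (sum-χ< (k % ℓ) (<⇒≤ (m%n<n k ℓ))) (sum-const ℓ (k / ℓ)) ⟩
      k % ℓ + ℓ * (k / ℓ)
        ≡⟨ ≡.sym (k≡k%ℓ+ℓ*[k/ℓ] k) ⟩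
      k ∎
      where open ≡.≡-Reasoning

open Exponents

module PowerSeries {a ℓr} (K : Field a ℓr) where
  open FPS K hiding (zero)
  open RingProperties ring using (-0#≈0#; -‿+-comm; -‿distribˡ-*; -‿involutive)
  module K-Solver = Solver commutativeSemiring
  module ≈-Reasoning = SetoidReasoning setoid

  1≉0 : ¬ (1# ≈ 0#)
  1≉0 1≈0 = 0≉1 (sym 1≈0)

  x*y≈0⇒x≈0 : ∀ {x y} → ¬ (y ≈ 0#) → x * y ≈ 0# → x ≈ 0#
  x*y≈0⇒x≈0 {x} {y} y≉0 xy≈0 = begin
    x               ≈⟨ *-identityʳ x ⟨
    x * 1#          ≈⟨ *-cong refl (⁻¹-inverse y y≉0) ⟨
    x * (y * y ⁻¹)  ≈⟨ *-assoc x y (y ⁻¹) ⟨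
    (x * y) * y ⁻¹  ≈⟨ *-cong xy≈0 refl ⟩
    0# * y ⁻¹       ≈⟨ zeroˡ _ ⟩
    0#              ∎
    where open ≈-Reasoning

  x*y≉0 : ∀ {x y} → ¬ (x ≈ 0#) → ¬ (y ≈ 0#) → ¬ (x * y ≈ 0#)
  x*y≉0 {x} {y} x≉0 y≉0 xy≈0 = y≉0 (x*y≈0⇒x≈0 x≉0 (trans (*-comm y x) xy≈0))

  x*y≉0⇒x≉0 : ∀ {x y} → ¬ (x * y ≈ 0#) → ¬ (x ≈ 0#)
  x*y≉0⇒x≉0 {x} {y} xy≉0 x≈0 = xy≉0 (trans (*-cong x≈0 refl) (zeroˡ y))

  x*y≉0⇒y≉0 : ∀ {x y} → ¬ (x * y ≈ 0#) → ¬ (y ≈ 0#)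
  x*y≉0⇒y≉0 {x} {y} xy≉0 y≈0 = xy≉0 (trans (*-cong refl y≈0) (zeroʳ x))

  x+[y-x]≈y : ∀ x y → x + (y + - x) ≈ y
  x+[y-x]≈y x y = trans (+-cong refl (+-comm y (- x)))
    (trans (sym (+-assoc x (- x) y)) (trans (+-cong (-‿inverseʳ x) refl) (+-identityˡ y)))

  -- Finite sums

  Σ≤-cong : ∀ n {u v : ℕ → Carrier} → (∀ i → u i ≈ v i) → Σ≤ n u ≈ Σ≤ n v
  Σ≤-cong zero    u≈v = u≈v 0
  Σ≤-cong (suc n) u≈v = +-cong (Σ≤-cong n u≈v) (u≈v (suc n))

  Σ≤-cong≤ : ∀ n {u v : ℕ → Carrier} → (∀ i → i ≤ n → u i ≈ v i) → Σ≤ n u ≈ Σ≤ n v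
  Σ≤-cong≤ zero    u≈v = u≈v 0 z≤n
  Σ≤-cong≤ (suc n) u≈v = +-cong (Σ≤-cong≤ n (λ i i≤n → u≈v i (m≤n⇒m≤1+n i≤n))) (u≈v (suc n) ≤-refl)

  Σ≤-zero : ∀ n {u : ℕ → Carrier} → (∀ i → i ≤ n → u i ≈ 0#) → Σ≤ n u ≈ 0#
  Σ≤-zero zero    u≈0 = u≈0 0 z≤n
  Σ≤-zero (suc n) u≈0 = trans (+-cong (Σ≤-zero n (λ i i≤n → u≈0 i (m≤n⇒m≤1+n i≤n))) (u≈0 (suc n) ≤-refl)) (+-identityˡ 0#)

  Σ≤-distrib-+ : ∀ n (u v : ℕ → Carrier) → Σ≤ n (λ i → u i + v i) ≈ Σ≤ n u + Σ≤ n v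
  Σ≤-distrib-+ zero    u v = refl
  Σ≤-distrib-+ (suc n) u v = trans (+-cong (Σ≤-distrib-+ n u v) refl)
    (solve 4 (λ a b c d → (a :+ b) :+ (c :+ d) := (a :+ c) :+ (b :+ d)) refl _ _ _ _)
    where open K-Solver using (solve; _:=_; _:+_)

  *-distribˡ-Σ≤ : ∀ n x (u : ℕ → Carrier) → x * Σ≤ n u ≈ Σ≤ n (λ i → x * u i)
  *-distribˡ-Σ≤ zero    x u = refl
  *-distribˡ-Σ≤ (suc n) x u = trans (distribˡ x _ _) (+-cong (*-distribˡ-Σ≤ n x u) refl)

  *-distribʳ-Σ≤ : ∀ n x (u : ℕ → Carrier) → Σ≤ n u * x ≈ Σ≤ n (λ i → u i * x)
  *-distribʳ-Σ≤ zero    x u = refl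
  *-distribʳ-Σ≤ (suc n) x u = trans (distribʳ x _ _) (+-cong (*-distribʳ-Σ≤ n x u) refl)

  -‿distrib-Σ≤ : ∀ n (u : ℕ → Carrier) → - Σ≤ n u ≈ Σ≤ n (λ i → - u i)
  -‿distrib-Σ≤ zero    u = refl
  -‿distrib-Σ≤ (suc n) u = trans (sym (-‿+-comm _ _)) (+-cong (-‿distrib-Σ≤ n u) refl)

  Σ≤-head : ∀ n (u : ℕ → Carrier) → Σ≤ (suc n) u ≈ u 0 + Σ≤ n (λ i → u (suc i))
  Σ≤-head zero    u = refl
  Σ≤-head (suc n) u = trans (+-cong (Σ≤-head n u) refl) (+-assoc _ _ _)

  Σ≤-reverse : ∀ n (u : ℕ → Carrier) → Σ≤ n u ≈ Σ≤ n (λ i → u (n ∸ i))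
  Σ≤-reverse zero    u = refl
  Σ≤-reverse (suc n) u = trans (+-cong (Σ≤-reverse n u) refl)
    (trans (+-comm _ _) (sym (Σ≤-head n (λ i → u (suc n ∸ i)))))

  Σ≤-comm : ∀ n m (u : ℕ → ℕ → Carrier) →
    Σ≤ n (λ j → Σ≤ m (λ i → u j i)) ≈ Σ≤ m (λ i → Σ≤ n (λ j → u j i))
  Σ≤-comm zero    m u = refl
  Σ≤-comm (suc n) m u = trans (+-cong (Σ≤-comm n m u) refl)
    (sym (Σ≤-distrib-+ m (λ i → Σ≤ n (λ j → u j i)) (u (suc n))))

  Σ≤-truncate : ∀ n i (u : ℕ → Carrier) → i ≤ n → (∀ j → i < j → j ≤ n → u j ≈ 0#) → Σ≤ n u ≈ Σ≤ i u
  Σ≤-truncate zero    .zero u z≤n _   = refl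
  Σ≤-truncate (suc n) i     u i≤  u≈0 with m≤n⇒m<n∨m≡n i≤
  ... | inj₂ ≡.refl       = refl
  ... | inj₁ (s≤s i≤n) =
    trans (+-cong (Σ≤-truncate n i u i≤n (λ j i<j j≤n → u≈0 j i<j (m≤n⇒m≤1+n j≤n)))
                  (u≈0 (suc n) (s≤s i≤n) ≤-refl))
          (+-identityʳ _)

  -- The ring of formal power series

  𝟘 : Series
  𝟘 _ = 0#

  ⊝_ : Series → Series
  (⊝ A) n = - A n

  ≋-setoid : Setoid a ℓr
  ≋-setoid = record
    { Carrier       = Series
    ; _≈_           = _≋_
    ; isEquivalence = record
      { refl  = λ _ → refl
      ; sym   = λ A≋B n → sym (A≋B n)
      ; trans = λ A≋B B≋C n → trans (A≋B n) (B≋C n)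
      }
    }

  module ≋ = Setoid ≋-setoid using (refl; sym; trans)
  module ≋-Reasoning = SetoidReasoning ≋-setoid

  ⊕-cong : ∀ {A A′ B B′} → A ≋ A′ → B ≋ B′ → A ⊕ B ≋ A′ ⊕ B′
  ⊕-cong A≋A′ B≋B′ n = +-cong (A≋A′ n) (B≋B′ n)

  ⊖-cong : ∀ {A A′ B B′} → A ≋ A′ → B ≋ B′ → A ⊖ B ≋ A′ ⊖ B′
  ⊖-cong A≋A′ B≋B′ n = +-cong (A≋A′ n) (-‿cong (B≋B′ n))

  ⊛-cong : ∀ {A A′ B B′} → A ≋ A′ → B ≋ B′ → A ⊛ B ≋ A′ ⊛ B′
  ⊛-cong A≋A′ B≋B′ n = Σ≤-cong n (λ i → *-cong (A≋A′ i) (B≋B′ (n ∸ i)))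

  shift-cong : ∀ {A B} → A ≋ B → shift A ≋ shift B
  shift-cong A≋B n = A≋B (suc n)

  const-cong : ∀ {x y} → x ≈ y → const x ≋ const y
  const-cong x≈y zero    = x≈y
  const-cong x≈y (suc n) = refl

  shift-⊛ : ∀ A B → shift (A ⊛ B) ≋ A 0 • shift B ⊕ shift A ⊛ B
  shift-⊛ A B n = Σ≤-head n (λ i → A i * B (suc n ∸ i))

  ⊛-comm : ∀ A B → A ⊛ B ≋ B ⊛ A
  ⊛-comm A B n = trans (Σ≤-reverse n _) (Σ≤-cong≤ n (λ i i≤n →
    trans (*-comm _ _) (*-cong (≡.subst (λ k → B k ≈ B i) (≡.sym (m∸[m∸n]≡n i≤n)) refl) refl)))

  ⊛-distribˡ : ∀ A B C → A ⊛ (B ⊕ C) ≋ A ⊛ B ⊕ A ⊛ C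
  ⊛-distribˡ A B C n = trans (Σ≤-cong n (λ i → distribˡ _ _ _)) (Σ≤-distrib-+ n _ _)

  ⊛-distribʳ : ∀ A B C → (B ⊕ C) ⊛ A ≋ B ⊛ A ⊕ C ⊛ A
  ⊛-distribʳ A B C n = trans (Σ≤-cong n (λ i → distribʳ _ _ _)) (Σ≤-distrib-+ n _ _)

  •-⊛-assoc : ∀ x A B → (x • A) ⊛ B ≋ x • (A ⊛ B)
  •-⊛-assoc x A B n = trans (Σ≤-cong n (λ i → *-assoc _ _ _)) (sym (*-distribˡ-Σ≤ n x _))

  ⊛-•-comm : ∀ x A B → A ⊛ (x • B) ≋ x • (A ⊛ B)
  ⊛-•-comm x A B n =
    trans (Σ≤-cong n (λ i → solve 3 (λ a b c → a :* (b :* c) := b :* (a :* c)) refl (A i) x (B (n ∸ i))))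
          (sym (*-distribˡ-Σ≤ n x _))
    where open K-Solver using (solve; _:=_; _:*_)

  ⊝-⊛ : ∀ A B → (⊝ A) ⊛ B ≋ ⊝ (A ⊛ B)
  ⊝-⊛ A B n = trans (Σ≤-cong n (λ i → sym (-‿distribˡ-* (A i) (B (n ∸ i))))) (sym (-‿distrib-Σ≤ n _))

  𝟘-⊛ : ∀ A → 𝟘 ⊛ A ≋ 𝟘
  𝟘-⊛ A n = Σ≤-zero n (λ i _ → zeroˡ _)

  const-⊛ : ∀ x A → const x ⊛ A ≋ x • A
  const-⊛ x A zero    = refl
  const-⊛ x A (suc n) = trans (shift-⊛ (const x) A n) (trans (+-cong refl (shift-const-⊛ n)) (+-identityʳ _))
    where
    shift-const-⊛ : shift (const x) ⊛ A ≋ 𝟘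
    shift-const-⊛ n = Σ≤-zero n (λ i _ → zeroˡ _)

  const-⊛-const : ∀ x y → const x ⊛ const y ≋ const (x * y)
  const-⊛-const x y zero    = refl
  const-⊛-const x y (suc n) = trans (const-⊛ x (const y) (suc n)) (zeroʳ x)

  ⊛-assoc : ∀ A B C → (A ⊛ B) ⊛ C ≋ A ⊛ (B ⊛ C)
  ⊛-assoc A B C zero    = *-assoc _ _ _
  ⊛-assoc A B C (suc n) = begin
    ((A ⊛ B) ⊛ C) (suc n)
      ≈⟨ shift-⊛ (A ⊛ B) C n ⟩
    (A 0 * B 0) * C (suc n) + (shift (A ⊛ B) ⊛ C) n
      ≈⟨ +-cong refl (⊛-cong (shift-⊛ A B) (≋.refl {C}) n) ⟩
    (A 0 * B 0) * C (suc n) + ((A 0 • shift B ⊕ shift A ⊛ B) ⊛ C) n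
      ≈⟨ +-cong refl (⊛-distribʳ C _ _ n) ⟩
    (A 0 * B 0) * C (suc n) + (((A 0 • shift B) ⊛ C) n + ((shift A ⊛ B) ⊛ C) n)
      ≈⟨ +-cong refl (+-cong (•-⊛-assoc (A 0) (shift B) C n) (⊛-assoc (shift A) B C n)) ⟩
    (A 0 * B 0) * C (suc n) + (A 0 * (shift B ⊛ C) n + (shift A ⊛ (B ⊛ C)) n)
      ≈⟨ solve 5 (λ a b c d e → (a :* b) :* c :+ (a :* d :+ e) := a :* (b :* c :+ d) :+ e) refl _ _ _ _ _ ⟩
    A 0 * (B 0 * C (suc n) + (shift B ⊛ C) n) + (shift A ⊛ (B ⊛ C)) n
      ≈⟨ +-cong (*-cong refl (shift-⊛ B C n)) refl ⟨
    A 0 * (B ⊛ C) (suc n) + (shift A ⊛ (B ⊛ C)) n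
      ≈⟨ shift-⊛ A (B ⊛ C) n ⟨
    (A ⊛ (B ⊛ C)) (suc n) ∎
    where
    open ≈-Reasoning
    open K-Solver using (solve; _:=_; _:+_; _:*_)

  ⊛-identityˡ : ∀ A → const 1# ⊛ A ≋ A
  ⊛-identityˡ A n = trans (const-⊛ 1# A n) (*-identityˡ _)

  ⊛-identityʳ : ∀ A → A ⊛ const 1# ≋ A
  ⊛-identityʳ A n = trans (⊛-comm A (const 1#) n) (⊛-identityˡ A n)

  Series-commutativeRing : CommutativeRing a ℓr
  Series-commutativeRing = record
    { Carrier = Series ; _≈_ = _≋_ ; _+_ = _⊕_ ; _*_ = _⊛_ ; -_ = ⊝_ ; 0# = 𝟘 ; 1# = const 1#
    ; isCommutativeRing = record
      { isRing = record
        { +-isAbelianGroup = record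
          { isGroup = record
            { isMonoid = record
              { isSemigroup = record
                { isMagma = record { isEquivalence = Setoid.isEquivalence ≋-setoid ; ∙-cong = ⊕-cong }
                ; assoc   = λ A B C n → +-assoc _ _ _
                }
              ; identity = (λ A n → +-identityˡ _) , (λ A n → +-identityʳ _)
              }
            ; inverse = (λ A n → -‿inverseˡ _) , (λ A n → -‿inverseʳ _)
            ; ⁻¹-cong = λ A≋B n → -‿cong (A≋B n)
            }
          ; comm = λ A B n → +-comm _ _
          }
        ; *-cong     = ⊛-cong
        ; *-assoc    = ⊛-assoc
        ; *-identity = ⊛-identityˡ , ⊛-identityʳ
        ; distrib    = ⊛-distribˡ , ⊛-distribʳ
        }
      ; *-comm = ⊛-comm
      }
    }

  module S-Solver = Solver (CommutativeRing.commutativeSemiring Series-commutativeRing)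

  ⊛-identityʳ-≋ : ∀ A {U} → U ≋ const 1# → A ⊛ U ≋ A
  ⊛-identityʳ-≋ A U≋1 = ≋.trans (⊛-cong (≋.refl {A}) U≋1) (⊛-identityʳ A)

  ⊛-strict : ∀ H A B n → H 0 ≈ 0# → (∀ j → j < n → A j ≈ B j) → (H ⊛ A) n ≈ (H ⊛ B) n
  ⊛-strict H A B n H0≈0 A≈B = Σ≤-cong≤ n term
    where
    term : ∀ i → i ≤ n → H i * A (n ∸ i) ≈ H i * B (n ∸ i)
    term zero    _          = trans (*-cong H0≈0 refl) (trans (zeroˡ _) (sym (trans (*-cong H0≈0 refl) (zeroˡ _))))
    term (suc i) si≤n = *-cong refl (A≈B (n ∸ suc i) (lemma si≤n))
      where
      lemma : suc i ≤ n → n ∸ suc i < n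
      lemma (s≤s {n = n′} _) = s≤s (m∸n≤m n′ i)

  ⊛-leading : ∀ S E n → (∀ j → j < n → E j ≈ 0#) → (S ⊛ E) n ≈ S 0 * E n
  ⊛-leading S E n E≈0 = Σ≤-truncate n 0 _ z≤n (λ j 0<j j≤n →
    trans (*-cong refl (E≈0 (n ∸ j) (ℕ.∸-monoʳ-< 0<j j≤n))) (zeroʳ _))

  -- Powers and finite products

  pow-cong : ∀ {A B} k → A ≋ B → pow A k ≋ pow B k
  pow-cong zero    A≋B = ≋.refl
  pow-cong (suc k) A≋B = ⊛-cong A≋B (pow-cong k A≋B)

  pow-congʳ : ∀ A {j k} → j ≡ k → pow A j ≋ pow A k
  pow-congʳ A ≡.refl = ≋.refl

  pow-homo-+ : ∀ A j k → pow A (j ℕ.+ k) ≋ pow A j ⊛ pow A k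
  pow-homo-+ A zero    k = ≋.sym (⊛-identityˡ (pow A k))
  pow-homo-+ A (suc j) k = ≋.trans (⊛-cong ≋.refl (pow-homo-+ A j k)) (≋.sym (⊛-assoc A (pow A j) (pow A k)))

  pow-distrib-⊛ : ∀ A B k → pow (A ⊛ B) k ≋ pow A k ⊛ pow B k
  pow-distrib-⊛ A B zero    = ≋.sym (⊛-identityˡ (const 1#))
  pow-distrib-⊛ A B (suc k) = ≋.trans (⊛-cong ≋.refl (pow-distrib-⊛ A B k))
    (solve 4 (λ a b c d → (a :* b) :* (c :* d) := (a :* c) :* (b :* d)) ≋.refl A B (pow A k) (pow B k))
    where open S-Solver using (solve; _:=_; _:*_)

  pow-pow : ∀ A j k → pow (pow A j) k ≋ pow A (j ℕ.* k)
  pow-pow A j zero    = pow-congʳ A (≡.sym (ℕ.*-zeroʳ j))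
  pow-pow A j (suc k) = begin
    pow A j ⊛ pow (pow A j) k  ≈⟨ ⊛-cong ≋.refl (pow-pow A j k) ⟩
    pow A j ⊛ pow A (j ℕ.* k)  ≈⟨ pow-homo-+ A j (j ℕ.* k) ⟨
    pow A (j ℕ.+ j ℕ.* k)      ≡⟨ ≡.cong (pow A) (ℕ.*-suc j k) ⟨
    pow A (j ℕ.* suc k)        ∎
    where open ≋-Reasoning

  pow-one : ∀ k → pow (const 1#) k ≋ const 1#
  pow-one zero    = ≋.refl
  pow-one (suc k) = ≋.trans (⊛-identityˡ _) (pow-one k)

  pow-vanish : ∀ A → A 0 ≈ 0# → ∀ k n → n < k → pow A k n ≈ 0#
  pow-vanish A A0≈0 (suc k) n (s≤s n≤k) = Σ≤-zero n term≈0
    where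
    term≈0 : ∀ i → i ≤ n → A i * pow A k (n ∸ i) ≈ 0#
    term≈0 zero    _           = trans (*-cong A0≈0 refl) (zeroˡ _)
    term≈0 (suc i) (s≤s i<n) =
      trans (*-cong refl (pow-vanish A A0≈0 k (n ∸ suc i) (<-≤-trans (s≤s (m∸n≤m _ i)) n≤k))) (zeroʳ _)

  pow-≉0 : ∀ A k → ¬ (A 0 ≈ 0#) → ¬ (pow A k 0 ≈ 0#)
  pow-≉0 A zero    A0≉0 = 1≉0
  pow-≉0 A (suc k) A0≉0 = x*y≉0 A0≉0 (pow-≉0 A k A0≉0)

  pow-at-0-cong : ∀ A B k → A 0 ≈ B 0 → pow A k 0 ≈ pow B k 0
  pow-at-0-cong A B zero    A0≈B0 = refl
  pow-at-0-cong A B (suc k) A0≈B0 = *-cong A0≈B0 (pow-at-0-cong A B k A0≈B0)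

  Π-cong : ∀ n {F G : Fin n → Series} → (∀ i → F i ≋ G i) → Π n F ≋ Π n G
  Π-cong zero    F≋G = ≋.refl
  Π-cong (suc n) F≋G = ⊛-cong (F≋G Fin.zero) (Π-cong n (λ i → F≋G (Fin.suc i)))

  Π-distrib-⊛ : ∀ n (F G : Fin n → Series) → Π n (λ i → F i ⊛ G i) ≋ Π n F ⊛ Π n G
  Π-distrib-⊛ zero    F G = ≋.sym (⊛-identityˡ (const 1#))
  Π-distrib-⊛ (suc n) F G = ≋.trans (⊛-cong ≋.refl (Π-distrib-⊛ n (λ i → F (Fin.suc i)) (λ i → G (Fin.suc i))))
    (solve 4 (λ a b c d → (a :* b) :* (c :* d) := (a :* c) :* (b :* d)) ≋.refl
       (F Fin.zero) (G Fin.zero) (Π n (λ i → F (Fin.suc i))) (Π n (λ i → G (Fin.suc i))))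
    where open S-Solver using (solve; _:=_; _:*_)

  Π-const : ∀ n A → Π n (λ _ → A) ≋ pow A n
  Π-const zero    A = ≋.refl
  Π-const (suc n) A = ⊛-cong ≋.refl (Π-const n A)

  Π-pow : ∀ n (F : Fin n → Series) k → Π n (λ i → pow (F i) k) ≋ pow (Π n F) k
  Π-pow n F zero    = ≋.trans (Π-const n (const 1#)) (pow-one n)
  Π-pow n F (suc k) = ≋.trans (Π-distrib-⊛ n F (λ i → pow (F i) k)) (⊛-cong ≋.refl (Π-pow n F k))

  Π-pow-sum : ∀ n A (e : Fin n → ℕ) → Π n (λ i → pow A (e i)) ≋ pow A (sum e)
  Π-pow-sum zero    A e = ≋.refl
  Π-pow-sum (suc n) A e = ≋.trans (⊛-cong ≋.refl (Π-pow-sum n A (λ i → e (Fin.suc i))))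
    (≋.sym (pow-homo-+ A (e Fin.zero) (sum (λ i → e (Fin.suc i)))))

  Π-≉0 : ∀ n (F : Fin n → Series) → (∀ i → ¬ (F i 0 ≈ 0#)) → ¬ (Π n F 0 ≈ 0#)
  Π-≉0 zero    F F≉0 = 1≉0
  Π-≉0 (suc n) F F≉0 = x*y≉0 (F≉0 Fin.zero) (Π-≉0 n (λ i → F (Fin.suc i)) (λ i → F≉0 (Fin.suc i)))

  Π-≉0⇒≉0 : ∀ n (F : Fin n → Series) → ¬ (Π n F 0 ≈ 0#) → ∀ i → ¬ (F i 0 ≈ 0#)
  Π-≉0⇒≉0 (suc n) F Π≉0 Fin.zero    = x*y≉0⇒x≉0 Π≉0
  Π-≉0⇒≉0 (suc n) F Π≉0 (Fin.suc i) = Π-≉0⇒≉0 n (λ j → F (Fin.suc j)) (x*y≉0⇒y≉0 Π≉0) i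

  Π< : ∀ n → ℕ → (Fin n → Series) → Series
  Π< n r F = Π n (λ i → pow (F i) (χ< r i))

  Π<-distrib-⊛ : ∀ n r (F G : Fin n → Series) → Π< n r (λ i → F i ⊛ G i) ≋ Π< n r F ⊛ Π< n r G
  Π<-distrib-⊛ n r F G = ≋.trans (Π-cong n (λ i → pow-distrib-⊛ (F i) (G i) (χ< r i)))
                                 (Π-distrib-⊛ n (λ i → pow (F i) (χ< r i)) (λ i → pow (G i) (χ< r i)))

  Π<-const : ∀ n r A → r ≤ n → Π< n r (λ _ → A) ≋ pow A r
  Π<-const n r A r≤n = ≋.trans (Π-pow-sum n A (χ< r))
      (≡.subst (λ k → pow A (sum {n} (χ< r)) ≋ pow A k) (sum-χ< r r≤n) ≋.refl)

  Π<-last : ∀ n (F : Fin (suc n) → Series) → Π< (suc n) n F ⊛ F (fromℕ n) ≋ Π (suc n) F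
  Π<-last zero    F = ≋.trans (⊛-cong (⊛-identityˡ (const 1#)) (≋.refl {F Fin.zero})) (⊛-comm (const 1#) (F Fin.zero))
  Π<-last (suc n) F = begin
    ((F Fin.zero ⊛ const 1#) ⊛ Π<F′) ⊛ F (fromℕ (suc n))
      ≈⟨ ⊛-assoc (F Fin.zero ⊛ const 1#) Π<F′ (F (fromℕ (suc n))) ⟩
    (F Fin.zero ⊛ const 1#) ⊛ (Π<F′ ⊛ F (fromℕ (suc n)))
      ≈⟨ ⊛-cong (⊛-identityʳ (F Fin.zero)) (Π<-last n (λ i → F (Fin.suc i))) ⟩
    F Fin.zero ⊛ Π (suc n) (λ i → F (Fin.suc i))                  ∎
    where
    open ≋-Reasoning
    Π<F′ : Series
    Π<F′ = Π< (suc n) n (λ i → F (Fin.suc i))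

  -- Division by t

  shift-X : shift X ≋ const 1#
  shift-X zero    = refl
  shift-X (suc n) = refl

  X⊛-at-0 : ∀ A → (X ⊛ A) 0 ≈ 0#
  X⊛-at-0 A = zeroˡ _

  shift-X⊛ : ∀ A → shift (X ⊛ A) ≋ A
  shift-X⊛ A n = trans (shift-⊛ X A n)
    (trans (+-cong (zeroˡ _) (⊛-cong shift-X (≋.refl {A}) n)) (trans (+-identityˡ _) (⊛-identityˡ A n)))

  X⊛-shift : ∀ A → A 0 ≈ 0# → A ≋ X ⊛ shift A
  X⊛-shift A A0≈0 zero    = trans A0≈0 (sym (X⊛-at-0 (shift A)))
  X⊛-shift A A0≈0 (suc n) = sym (shift-X⊛ (shift A) n)

  X⊛-cancel : ∀ {A B} → X ⊛ A ≋ X ⊛ B → A ≋ B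
  X⊛-cancel {A} {B} XA≋XB = ≋.trans (≋.sym (shift-X⊛ A)) (≋.trans (shift-cong XA≋XB) (shift-X⊛ B))

  pow-X⊛-cancel : ∀ k {A B} → pow X k ⊛ A ≋ pow X k ⊛ B → A ≋ B
  pow-X⊛-cancel zero    {A} {B} eq = ≋.trans (≋.sym (⊛-identityˡ A)) (≋.trans eq (⊛-identityˡ B))
  pow-X⊛-cancel (suc k) {A} {B} eq = pow-X⊛-cancel k (X⊛-cancel
    (≋.trans (≋.sym (⊛-assoc X (pow X k) A)) (≋.trans eq (⊛-assoc X (pow X k) B))))

  shift-pow-Π : ∀ n {H} {F : Fin n → Series} → H 0 ≈ 0# → (∀ i → F i 0 ≈ 0#) → pow H n ≋ Π n F →
                pow (shift H) n ≋ Π n (λ i → shift (F i))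
  shift-pow-Π n {H} {F} H0≈0 F0≈0 H^n≋ΠF = pow-X⊛-cancel n (begin
    pow X n ⊛ pow (shift H) n                 ≈⟨ pow-distrib-⊛ X (shift H) n ⟨
    pow (X ⊛ shift H) n                       ≈⟨ pow-cong n (X⊛-shift H H0≈0) ⟨
    pow H n                                   ≈⟨ H^n≋ΠF ⟩
    Π n F                                     ≈⟨ Π-cong n (λ i → X⊛-shift (F i) (F0≈0 i)) ⟩
    Π n (λ i → X ⊛ shift (F i))               ≈⟨ Π-distrib-⊛ n (λ _ → X) (λ i → shift (F i)) ⟩
    Π n (λ _ → X) ⊛ Π n (λ i → shift (F i))   ≈⟨ ⊛-cong (Π-const n X) (≋.refl {Π n (λ i → shift (F i))}) ⟩
    pow X n ⊛ Π n (λ i → shift (F i))         ∎)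
    where open ≋-Reasoning

  -- Composition

  ∘-congˡ : ∀ {A A′} H → A ≋ A′ → A ∘ₛ H ≋ A′ ∘ₛ H
  ∘-congˡ H A≋A′ n = Σ≤-cong n (λ k → *-cong (A≋A′ k) refl)

  ∘-congʳ : ∀ A {H H′} → H ≋ H′ → A ∘ₛ H ≋ A ∘ₛ H′
  ∘-congʳ A H≋H′ n = Σ≤-cong n (λ k → *-cong refl (pow-cong k H≋H′ n))

  ∘-at-0 : ∀ A H → (A ∘ₛ H) 0 ≈ A 0
  ∘-at-0 A H = *-identityʳ (A 0)

  ∘-homo-⊕ : ∀ A B H → (A ⊕ B) ∘ₛ H ≋ A ∘ₛ H ⊕ B ∘ₛ H
  ∘-homo-⊕ A B H n = trans (Σ≤-cong n (λ k → distribʳ _ _ _)) (Σ≤-distrib-+ n _ _)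

  ∘-homo-• : ∀ x A H → (x • A) ∘ₛ H ≋ x • (A ∘ₛ H)
  ∘-homo-• x A H n = trans (Σ≤-cong n (λ k → *-assoc _ _ _)) (sym (*-distribˡ-Σ≤ n x _))

  ∘-homo-⊖ : ∀ A B H → (A ⊖ B) ∘ₛ H ≋ A ∘ₛ H ⊖ B ∘ₛ H
  ∘-homo-⊖ A B H = ≋.trans (∘-homo-⊕ A (⊝ B) H) (⊕-cong ≋.refl ∘-homo-⊝)
    where
    ∘-homo-⊝ : (⊝ B) ∘ₛ H ≋ ⊝ (B ∘ₛ H)
    ∘-homo-⊝ n = trans (Σ≤-cong n (λ k → sym (-‿distribˡ-* (B k) (pow H k n)))) (sym (-‿distrib-Σ≤ n _))

  const-∘ : ∀ x H → const x ∘ₛ H ≋ const x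
  const-∘ x H zero    = *-identityʳ x
  const-∘ x H (suc n) = trans (Σ≤-head n _) (trans (+-cong (zeroʳ x) (Σ≤-zero n (λ k _ → zeroˡ _))) (+-identityʳ _))

  𝟘-∘ : ∀ H → 𝟘 ∘ₛ H ≋ 𝟘
  𝟘-∘ H n = Σ≤-zero n (λ k _ → zeroˡ _)

  ∘-truncate : ∀ A H → H 0 ≈ 0# → ∀ m n → m ≤ n → Σ≤ n (λ k → A k * pow H k m) ≈ (A ∘ₛ H) m
  ∘-truncate A H H0≈0 m n m≤n =
    Σ≤-truncate n m _ m≤n (λ j m<j _ → trans (*-cong refl (pow-vanish H H0≈0 j m m<j)) (zeroʳ _))

  ∘-horner : ∀ A H → H 0 ≈ 0# → A ∘ₛ H ≋ const (A 0) ⊕ H ⊛ (shift A ∘ₛ H)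
  ∘-horner A H H0≈0 zero    =
    trans (*-identityʳ _) (sym (trans (+-cong refl (trans (*-cong H0≈0 refl) (zeroˡ _))) (+-identityʳ _)))
  ∘-horner A H H0≈0 (suc n) = begin
    Σ≤ (suc n) (λ k → A k * pow H k (suc n))
      ≈⟨ Σ≤-head n _ ⟩
    A 0 * 0# + Σ≤ n (λ k → A (suc k) * Σ≤ (suc n) (λ i → H i * pow H k (suc n ∸ i)))
      ≈⟨ +-cong (zeroʳ _) (Σ≤-cong n (λ k → trans (*-distribˡ-Σ≤ (suc n) _ _)
           (Σ≤-cong (suc n) (λ i → x*[y*z]≈y*[x*z] _ _ _)))) ⟩
    0# + Σ≤ n (λ k → Σ≤ (suc n) (λ i → H i * (A (suc k) * pow H k (suc n ∸ i))))
      ≈⟨ +-cong refl (Σ≤-comm n (suc n) _) ⟩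
    0# + Σ≤ (suc n) (λ i → Σ≤ n (λ k → H i * (A (suc k) * pow H k (suc n ∸ i))))
      ≈⟨ +-cong refl (Σ≤-cong (suc n) (λ i → sym (*-distribˡ-Σ≤ n (H i) _))) ⟩
    0# + Σ≤ (suc n) (λ i → H i * Σ≤ n (λ k → A (suc k) * pow H k (suc n ∸ i)))
      ≈⟨ +-cong refl (Σ≤-cong (suc n) inner) ⟩
    0# + (H ⊛ (shift A ∘ₛ H)) (suc n) ∎
    where
    open ≈-Reasoning
    x*[y*z]≈y*[x*z] : ∀ x y z → x * (y * z) ≈ y * (x * z)
    x*[y*z]≈y*[x*z] = solve 3 (λ x y z → x :* (y :* z) := y :* (x :* z)) refl
      where open K-Solver using (solve; _:=_; _:*_)
    inner : ∀ i → H i * Σ≤ n (λ k → A (suc k) * pow H k (suc n ∸ i)) ≈ H i * (shift A ∘ₛ H) (suc n ∸ i)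
    inner zero    = trans (*-cong H0≈0 refl) (trans (zeroˡ _) (sym (trans (*-cong H0≈0 refl) (zeroˡ _))))
    inner (suc i) = *-cong refl (∘-truncate (shift A) H H0≈0 (n ∸ i) n (m∸n≤m n i))

  ∘-homo-⊛ : ∀ A B H → H 0 ≈ 0# → (A ⊛ B) ∘ₛ H ≋ A ∘ₛ H ⊛ B ∘ₛ H
  ∘-homo-⊛ A B H H0≈0 n = <-rec Homo step n A B
    where
    Homo : ℕ → Set _
    Homo n = ∀ A B → ((A ⊛ B) ∘ₛ H) n ≈ (A ∘ₛ H ⊛ B ∘ₛ H) n

    horner-⊛ : ∀ A B → const (A 0 * B 0) ⊕ H ⊛ (A 0 • (shift B ∘ₛ H) ⊕ (shift A ∘ₛ H) ⊛ B ∘ₛ H)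
                       ≋ A ∘ₛ H ⊛ B ∘ₛ H
    horner-⊛ A B = begin
      const (A 0 * B 0) ⊕ H ⊛ (A 0 • Q ⊕ P ⊛ B ∘ₛ H)
        ≈⟨ ⊕-cong (≋.sym (const-⊛-const (A 0) (B 0)))
                  (⊛-cong (≋.refl {H}) (⊕-cong (≋.sym (const-⊛ (A 0) Q)) (⊛-cong (≋.refl {P}) (∘-horner B H H0≈0)))) ⟩
      const (A 0) ⊛ const (B 0) ⊕ H ⊛ (const (A 0) ⊛ Q ⊕ P ⊛ (const (B 0) ⊕ H ⊛ Q))
        ≈⟨ solve 5 (λ a b h p q → a :* b :+ h :* (a :* q :+ p :* (b :+ h :* q)) := (a :+ h :* p) :* (b :+ h :* q))
                   ≋.refl (const (A 0)) (const (B 0)) H P Q ⟩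
      (const (A 0) ⊕ H ⊛ P) ⊛ (const (B 0) ⊕ H ⊛ Q)
        ≈⟨ ⊛-cong (∘-horner A H H0≈0) (∘-horner B H H0≈0) ⟨
      A ∘ₛ H ⊛ B ∘ₛ H ∎
      where
      open ≋-Reasoning
      open S-Solver using (solve; _:=_; _:+_; _:*_)
      P : Series
      P = shift A ∘ₛ H
      Q : Series
      Q = shift B ∘ₛ H

    step : ∀ n → (∀ {j} → j < n → Homo j) → Homo n
    step n IH A B = begin
      ((A ⊛ B) ∘ₛ H) n
        ≈⟨ ∘-horner (A ⊛ B) H H0≈0 n ⟩
      (const (A 0 * B 0) ⊕ H ⊛ (shift (A ⊛ B) ∘ₛ H)) n
        ≈⟨ ⊕-cong (≋.refl {const (A 0 * B 0)}) (⊛-cong (≋.refl {H}) (∘-congˡ H (shift-⊛ A B))) n ⟩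
      (const (A 0 * B 0) ⊕ H ⊛ ((A 0 • shift B ⊕ shift A ⊛ B) ∘ₛ H)) n
        ≈⟨ +-cong refl (⊛-strict H _ _ n H0≈0 (λ j j<n → lower j (IH j<n (shift A) B))) ⟩
      (const (A 0 * B 0) ⊕ H ⊛ (A 0 • (shift B ∘ₛ H) ⊕ (shift A ∘ₛ H) ⊛ B ∘ₛ H)) n
        ≈⟨ horner-⊛ A B n ⟩
      (A ∘ₛ H ⊛ B ∘ₛ H) n ∎
      where
      open ≈-Reasoning
      lower : ∀ j → ((shift A ⊛ B) ∘ₛ H) j ≈ ((shift A ∘ₛ H) ⊛ B ∘ₛ H) j →
              ((A 0 • shift B ⊕ shift A ⊛ B) ∘ₛ H) j ≈ (A 0 • (shift B ∘ₛ H) ⊕ (shift A ∘ₛ H) ⊛ B ∘ₛ H) j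
      lower j eq = trans (∘-homo-⊕ (A 0 • shift B) (shift A ⊛ B) H j) (+-cong (∘-homo-• (A 0) (shift B) H j) eq)

  ∘-homo-pow : ∀ A H k → H 0 ≈ 0# → pow A k ∘ₛ H ≋ pow (A ∘ₛ H) k
  ∘-homo-pow A H zero    H0≈0 = const-∘ 1# H
  ∘-homo-pow A H (suc k) H0≈0 = ≋.trans (∘-homo-⊛ A (pow A k) H H0≈0) (⊛-cong ≋.refl (∘-homo-pow A H k H0≈0))

  ∘-homo-Π : ∀ n (F : Fin n → Series) H → H 0 ≈ 0# → Π n F ∘ₛ H ≋ Π n (λ i → F i ∘ₛ H)
  ∘-homo-Π zero    F H H0≈0 = const-∘ 1# H
  ∘-homo-Π (suc n) F H H0≈0 = ≋.trans (∘-homo-⊛ _ _ H H0≈0) (⊛-cong ≋.refl (∘-homo-Π n _ H H0≈0))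

  X-∘ : ∀ H → H 0 ≈ 0# → X ∘ₛ H ≋ H
  X-∘ H H0≈0 = begin
    X ∘ₛ H                          ≈⟨ ∘-horner X H H0≈0 ⟩
    const 0# ⊕ H ⊛ (shift X ∘ₛ H)   ≈⟨ const-0-⊕ ⟩
    H ⊛ (shift X ∘ₛ H)              ≈⟨ ⊛-cong (≋.refl {H}) (≋.trans (∘-congˡ H shift-X) (const-∘ 1# H)) ⟩
    H ⊛ const 1#                    ≈⟨ ⊛-identityʳ H ⟩
    H                               ∎
    where
    open ≋-Reasoning
    const-0-⊕ : ∀ {A} → const 0# ⊕ A ≋ A
    const-0-⊕ zero    = +-identityˡ _
    const-0-⊕ (suc n) = +-identityˡ _

  ∘-X : ∀ A → A ∘ₛ X ≋ A
  ∘-X A zero    = *-identityʳ _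
  ∘-X A (suc n) = trans (∘-horner A X refl (suc n))
    (trans (+-identityˡ _) (trans (shift-X⊛ (shift A ∘ₛ X) n) (∘-X (shift A) n)))

  ∘-assoc : ∀ A G H → G 0 ≈ 0# → H 0 ≈ 0# → (A ∘ₛ G) ∘ₛ H ≋ A ∘ₛ (G ∘ₛ H)
  ∘-assoc A G H G0≈0 H0≈0 n = <-rec Assoc step n A
    where
    GH0≈0 : (G ∘ₛ H) 0 ≈ 0#
    GH0≈0 = trans (∘-at-0 G H) G0≈0
    Assoc : ℕ → Set _
    Assoc n = ∀ A → ((A ∘ₛ G) ∘ₛ H) n ≈ (A ∘ₛ (G ∘ₛ H)) n
    step : ∀ n → (∀ {j} → j < n → Assoc j) → Assoc n
    step n IH A = begin
      ((A ∘ₛ G) ∘ₛ H) n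
        ≈⟨ ∘-congˡ H (∘-horner A G G0≈0) n ⟩
      ((const (A 0) ⊕ G ⊛ (shift A ∘ₛ G)) ∘ₛ H) n
        ≈⟨ ∘-homo-⊕ _ _ H n ⟩
      (const (A 0) ∘ₛ H ⊕ (G ⊛ (shift A ∘ₛ G)) ∘ₛ H) n
        ≈⟨ ⊕-cong (const-∘ (A 0) H) (∘-homo-⊛ G _ H H0≈0) n ⟩
      (const (A 0) ⊕ (G ∘ₛ H) ⊛ ((shift A ∘ₛ G) ∘ₛ H)) n
        ≈⟨ +-cong refl (⊛-strict (G ∘ₛ H) _ _ n GH0≈0 (λ j j<n → IH j<n (shift A))) ⟩
      (const (A 0) ⊕ (G ∘ₛ H) ⊛ (shift A ∘ₛ (G ∘ₛ H))) n
        ≈⟨ ∘-horner A (G ∘ₛ H) GH0≈0 n ⟨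
      (A ∘ₛ (G ∘ₛ H)) n ∎
      where open ≈-Reasoning

  module CompositionalInverse (H H̄ : Series) (H0≈0 : H 0 ≈ 0#) (H̄0≈0 : H̄ 0 ≈ 0#) (H̄∘H≋X : H̄ ∘ₛ H ≋ X) where

    ∘-cancel : ∀ A → (A ∘ₛ H̄) ∘ₛ H ≋ A
    ∘-cancel A = ≋.trans (∘-assoc A H̄ H H̄0≈0 H0≈0) (≋.trans (∘-congʳ A H̄∘H≋X) (∘-X A))

    shift-∘-cancel : ∀ A → A 0 ≈ 0# → shift H ⊛ (shift (A ∘ₛ H̄) ∘ₛ H) ≋ shift A
    shift-∘-cancel A A0≈0 = X⊛-cancel (begin
      X ⊛ (shift H ⊛ Y)
        ≈⟨ ⊛-assoc X (shift H) Y ⟨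
      (X ⊛ shift H) ⊛ Y
        ≈⟨ ⊛-cong (≋.trans (≋.sym (X⊛-shift H H0≈0)) (≋.sym (X-∘ H H0≈0))) (≋.refl {Y}) ⟩
      (X ∘ₛ H) ⊛ Y
        ≈⟨ ∘-homo-⊛ X (shift (A ∘ₛ H̄)) H H0≈0 ⟨
      (X ⊛ shift (A ∘ₛ H̄)) ∘ₛ H
        ≈⟨ ∘-congˡ H (X⊛-shift (A ∘ₛ H̄) (trans (∘-at-0 A H̄) A0≈0)) ⟨
      (A ∘ₛ H̄) ∘ₛ H
        ≈⟨ ∘-cancel A ⟩
      A
        ≈⟨ X⊛-shift A A0≈0 ⟩
      X ⊛ shift A                   ∎)
      where
      open ≋-Reasoning
      Y : Series
      Y = shift (A ∘ₛ H̄) ∘ₛ H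

    shift-inverse : shift H ⊛ (shift H̄ ∘ₛ H) ≋ const 1#
    shift-inverse = ≋.trans (⊛-cong (≋.refl {shift H}) (∘-congˡ H (shift-cong (≋.sym (X-∘ H̄ H̄0≈0)))))
                            (≋.trans (shift-∘-cancel X refl) shift-X)

  -- The fundamental theorem of Riordan arrays, for a matrix whose j-th column is H^j·W.
  Σ≤-columns-∘ : ∀ (col : ℕ → Series) A H W → H 0 ≈ 0# → (∀ j → A j ≈ 0# ⊎ col j ≋ pow H j ⊛ W) →
                ∀ n → Σ≤ n (λ j → col j n * A j) ≈ ((A ∘ₛ H) ⊛ W) n
  Σ≤-columns-∘ col A H W H0≈0 col≋ n = begin
    Σ≤ n (λ j → col j n * A j)
      ≈⟨ Σ≤-cong n term ⟩
    Σ≤ n (λ j → (pow H j ⊛ W) n * A j)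
      ≈⟨ Σ≤-cong n (λ j → trans (*-distribʳ-Σ≤ n (A j) _) (Σ≤-cong n (λ i → rearrange (pow H j i) (W (n ∸ i)) (A j)))) ⟩
    Σ≤ n (λ j → Σ≤ n (λ i → (A j * pow H j i) * W (n ∸ i)))
      ≈⟨ Σ≤-comm n n (λ j i → (A j * pow H j i) * W (n ∸ i)) ⟩
    Σ≤ n (λ i → Σ≤ n (λ j → (A j * pow H j i) * W (n ∸ i)))
      ≈⟨ Σ≤-cong≤ n (λ i i≤n → trans (sym (*-distribʳ-Σ≤ n (W (n ∸ i)) _)) (*-cong (∘-truncate A H H0≈0 i n i≤n) refl)) ⟩
    ((A ∘ₛ H) ⊛ W) n ∎
    where
    open ≈-Reasoning
    rearrange : ∀ x y z → (x * y) * z ≈ (z * x) * y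
    rearrange = solve 3 (λ x y z → (x :* y) :* z := (z :* x) :* y) refl
      where open K-Solver using (solve; _:=_; _:*_)
    term : ∀ j → col j n * A j ≈ (pow H j ⊛ W) n * A j
    term j with col≋ j
    ... | inj₁ Aj≈0 = trans (*-cong refl Aj≈0) (trans (zeroʳ _) (sym (trans (*-cong refl Aj≈0) (zeroʳ _))))
    ... | inj₂ col≋HW = *-cong (col≋HW n) refl

  -- Reciprocals

  inv-inverseʳ : ∀ A → ¬ (A 0 ≈ 0#) → A ⊛ inv A ≋ const 1#
  inv-inverseʳ A A0≉0 = begin
    A ⊛ inv A
      ≈⟨ ⊛-•-comm a⁻¹ A Γ ⟩
    a⁻¹ • (A ⊛ Γ)
      ≈⟨ •-⊛-assoc a⁻¹ A Γ ⟨
    (a⁻¹ • A) ⊛ Γ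
      ≈⟨ ⊛-cong a⁻¹A≋1-U (≋.refl {Γ}) ⟩
    (const 1# ⊕ ⊝ U) ⊛ Γ
      ≈⟨ ⊛-distribʳ Γ (const 1#) (⊝ U) ⟩
    const 1# ⊛ Γ ⊕ (⊝ U) ⊛ Γ
      ≈⟨ ⊕-cong (⊛-identityˡ Γ) (⊝-⊛ U Γ) ⟩
    Γ ⊕ ⊝ (U ⊛ Γ)
      ≈⟨ ⊕-cong geometric (≋.refl {⊝ (U ⊛ Γ)}) ⟩
    (const 1# ⊕ U ⊛ Γ) ⊕ ⊝ (U ⊛ Γ)
      ≈⟨ (λ n → trans (+-assoc _ _ _) (trans (+-cong refl (-‿inverseʳ _)) (+-identityʳ _))) ⟩
    const 1#                         ∎
    where
    open ≋-Reasoning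
    a⁻¹ : Carrier
    a⁻¹ = A 0 ⁻¹
    U : Series
    U = const 1# ⊖ a⁻¹ • A
    Γ : Series
    Γ = geom ∘ₛ U
    U0≈0 : U 0 ≈ 0#
    U0≈0 = trans (+-cong refl (-‿cong (trans (*-comm _ _) (⁻¹-inverse (A 0) A0≉0)))) (-‿inverseʳ 1#)
    -- 1/(1 - U) = 1 + U/(1 - U), by Horner's rule for the geometric series
    geometric : Γ ≋ const 1# ⊕ U ⊛ Γ
    geometric = ∘-horner geom U U0≈0
    a⁻¹A≋1-U : a⁻¹ • A ≋ const 1# ⊕ ⊝ U
    a⁻¹A≋1-U n = sym (trans (+-cong refl (sym (-‿+-comm _ _)))
      (trans (sym (+-assoc _ _ _)) (trans (+-cong (-‿inverseʳ _) (-‿involutive _)) (+-identityˡ _))))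

  inv-inverseˡ : ∀ A → ¬ (A 0 ≈ 0#) → inv A ⊛ A ≋ const 1#
  inv-inverseˡ A A0≉0 = ≋.trans (⊛-comm (inv A) A) (inv-inverseʳ A A0≉0)

  inv-unique : ∀ A B → ¬ (A 0 ≈ 0#) → A ⊛ B ≋ const 1# → B ≋ inv A
  inv-unique A B A0≉0 AB≋1 = begin
    B                     ≈⟨ ⊛-identityʳ B ⟨
    B ⊛ const 1#          ≈⟨ ⊛-cong (≋.refl {B}) (inv-inverseʳ A A0≉0) ⟨
    B ⊛ (A ⊛ inv A)       ≈⟨ solve 3 (λ b a i → b :* (a :* i) := (a :* b) :* i) ≋.refl B A (inv A) ⟩
    (A ⊛ B) ⊛ inv A       ≈⟨ ⊛-cong AB≋1 (≋.refl {inv A}) ⟩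
    const 1# ⊛ inv A      ≈⟨ ⊛-identityˡ (inv A) ⟩
    inv A                 ∎
    where
    open ≋-Reasoning
    open S-Solver using (solve; _:=_; _:*_)

  inv-≉0 : ∀ A → ¬ (A 0 ≈ 0#) → ¬ (inv A 0 ≈ 0#)
  inv-≉0 A A0≉0 inv0≈0 = 1≉0 (trans (sym (inv-inverseʳ A A0≉0 0)) (trans (*-cong refl inv0≈0) (zeroʳ _)))

  inv-cong : ∀ {A B} → ¬ (A 0 ≈ 0#) → A ≋ B → inv A ≋ inv B
  inv-cong {A} {B} A0≉0 A≋B = inv-unique B (inv A) (λ B0≈0 → A0≉0 (trans (A≋B 0) B0≈0))
    (≋.trans (⊛-cong (≋.sym A≋B) (≋.refl {inv A})) (inv-inverseʳ A A0≉0))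

  inv-distrib-⊛ : ∀ A B → ¬ (A 0 ≈ 0#) → ¬ (B 0 ≈ 0#) → inv (A ⊛ B) ≋ inv A ⊛ inv B
  inv-distrib-⊛ A B A0≉0 B0≉0 = ≋.sym (inv-unique (A ⊛ B) (inv A ⊛ inv B) (x*y≉0 A0≉0 B0≉0) (begin
    (A ⊛ B) ⊛ (inv A ⊛ inv B)
      ≈⟨ solve 4 (λ a b i j → (a :* b) :* (i :* j) := (a :* i) :* (b :* j)) ≋.refl A B (inv A) (inv B) ⟩
    (A ⊛ inv A) ⊛ (B ⊛ inv B)
      ≈⟨ ⊛-cong (inv-inverseʳ A A0≉0) (inv-inverseʳ B B0≉0) ⟩
    const 1# ⊛ const 1#
      ≈⟨ ⊛-identityˡ (const 1#) ⟩
    const 1#                       ∎))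
    where
    open ≋-Reasoning
    open S-Solver using (solve; _:=_; _:*_)

  inv-involutive : ∀ A → ¬ (A 0 ≈ 0#) → inv (inv A) ≋ A
  inv-involutive A A0≉0 = ≋.sym (inv-unique (inv A) A (inv-≉0 A A0≉0) (inv-inverseˡ A A0≉0))

  inv-const : ∀ x → ¬ (x ≈ 0#) → inv (const x) ≋ const (x ⁻¹)
  inv-const x x≉0 = ≋.sym (inv-unique (const x) (const (x ⁻¹)) x≉0
    (≋.trans (const-⊛-const x (x ⁻¹)) (const-cong (⁻¹-inverse x x≉0))))

  pow-inverse : ∀ A k → ¬ (A 0 ≈ 0#) → pow A k ⊛ pow (inv A) k ≋ const 1#
  pow-inverse A k A0≉0 =
    ≋.trans (≋.sym (pow-distrib-⊛ A (inv A) k)) (≋.trans (pow-cong k (inv-inverseʳ A A0≉0)) (pow-one k))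

  ∘-inverseʳ : ∀ A H → ¬ (A 0 ≈ 0#) → H 0 ≈ 0# → A ∘ₛ H ⊛ inv A ∘ₛ H ≋ const 1#
  ∘-inverseʳ A H A0≉0 H0≈0 =
    ≋.trans (≋.sym (∘-homo-⊛ A (inv A) H H0≈0)) (≋.trans (∘-congˡ H (inv-inverseʳ A A0≉0)) (const-∘ 1# H))

  -- Residues modulo ℓ

  module Residues (ℓ : ℕ) .{{ℓ≢0 : ℕ.NonZero ℓ}} where

    infix 4 _≡ₘ_
    record _≡ₘ_ (x y : ℕ) : Set where
      constructor mod-≡
      field %-≡ : x % ℓ ≡ y % ℓ
    open _≡ₘ_ public

    ≡ₘ-refl : ∀ {x} → x ≡ₘ x
    ≡ₘ-refl = mod-≡ ≡.refl

    ≡ₘ-reflexive : ∀ {x y} → x ≡ y → x ≡ₘ y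
    ≡ₘ-reflexive ≡.refl = ≡ₘ-refl

    ≡ₘ-sym : ∀ {x y} → x ≡ₘ y → y ≡ₘ x
    ≡ₘ-sym (mod-≡ eq) = mod-≡ (≡.sym eq)

    ≡ₘ-trans : ∀ {x y z} → x ≡ₘ y → y ≡ₘ z → x ≡ₘ z
    ≡ₘ-trans (mod-≡ eq) (mod-≡ eq′) = mod-≡ (≡.trans eq eq′)

    +-cong-≡ₘ : ∀ {x y u v} → x ≡ₘ u → y ≡ₘ v → x ℕ.+ y ≡ₘ u ℕ.+ v
    +-cong-≡ₘ {x} {y} {u} {v} (mod-≡ eq) (mod-≡ eq′) = mod-≡ (begin
      (x ℕ.+ y) % ℓ              ≡⟨ %-distribˡ-+ x y ℓ ⟩
      (x % ℓ ℕ.+ y % ℓ) % ℓ      ≡⟨ ≡.cong₂ (λ p q → (p ℕ.+ q) % ℓ) eq eq′ ⟩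
      (u % ℓ ℕ.+ v % ℓ) % ℓ      ≡⟨ %-distribˡ-+ u v ℓ ⟨
      (u ℕ.+ v) % ℓ              ∎)
      where open ≡.≡-Reasoning

    +ℓ-≡ₘ : ∀ x → x ℕ.+ ℓ ≡ₘ x
    +ℓ-≡ₘ x = mod-≡ ([m+n]%n≡m%n x ℓ)

    suc-injective-≡ₘ : ∀ {x y} → suc x ≡ₘ suc y → x ≡ₘ y
    suc-injective-≡ₘ {x} {y} sx≡sy = ≡ₘ-trans (≡ₘ-sym (+ℓ-≡ₘ x)) (≡ₘ-trans (≡ₘ-reflexive (x+ℓ≡sx+p x))
      (≡ₘ-trans (+-cong-≡ₘ sx≡sy ≡ₘ-refl) (≡ₘ-trans (≡ₘ-reflexive (≡.sym (x+ℓ≡sx+p y))) (+ℓ-≡ₘ y))))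
      where
      x+ℓ≡sx+p : ∀ x → x ℕ.+ ℓ ≡ suc x ℕ.+ ℕ.pred ℓ
      x+ℓ≡sx+p x = ≡.trans (≡.cong (x ℕ.+_) (≡.sym (ℕ.suc-pred ℓ))) (ℕ.+-suc x (ℕ.pred ℓ))

    _≡ₘ?_ : ∀ x y → Dec (x ≡ₘ y)
    x ≡ₘ? y = Dec.map′ mod-≡ %-≡ (x % ℓ ℕ.≟ y % ℓ)

    -- Homog 0 is K[[t^ℓ]] and Homog 1 is tK[[t^ℓ]].
    record Homog (s : ℕ) (A : Series) : Set ℓr where
      constructor homog
      field vanish : ∀ n → ¬ (n ≡ₘ s) → A n ≈ 0#
    open Homog public

    Homog-cong : ∀ {s A B} → A ≋ B → Homog s A → Homog s B
    Homog-cong A≋B hA = homog λ n n≢s → trans (sym (A≋B n)) (vanish hA n n≢s)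

    Homog-≡ : ∀ {s t A} → s ≡ t → Homog s A → Homog t A
    Homog-≡ ≡.refl hA = hA

    Homog-≡ₘ : ∀ {s t A} → s ≡ₘ t → Homog s A → Homog t A
    Homog-≡ₘ s≡t hA = homog λ n n≢t → vanish hA n (λ n≡s → n≢t (≡ₘ-trans n≡s s≡t))

    Homog-const : ∀ x → Homog 0 (const x)
    Homog-const x = homog λ where
      zero    0≢0 → contradiction ≡ₘ-refl 0≢0
      (suc n) _   → refl

    Homog-X : Homog 1 X
    Homog-X = homog λ where
      zero          _   → refl
      (suc zero)    1≢1 → contradiction ≡ₘ-refl 1≢1
      (suc (suc n)) _   → refl

    Homog-⊕ : ∀ {s A B} → Homog s A → Homog s B → Homog s (A ⊕ B)
    Homog-⊕ hA hB = homog λ n n≢s → trans (+-cong (vanish hA n n≢s) (vanish hB n n≢s)) (+-identityˡ 0#)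

    Homog-• : ∀ {s} x {A} → Homog s A → Homog s (x • A)
    Homog-• x hA = homog λ n n≢s → trans (*-cong refl (vanish hA n n≢s)) (zeroʳ x)

    Homog-⊖ : ∀ {s A B} → Homog s A → Homog s B → Homog s (A ⊖ B)
    Homog-⊖ hA hB = homog λ n n≢s →
      trans (+-cong (vanish hA n n≢s) (trans (-‿cong (vanish hB n n≢s)) -0#≈0#)) (+-identityˡ 0#)

    Homog-⊛ : ∀ {s t A B} → Homog s A → Homog t B → Homog (s ℕ.+ t) (A ⊛ B)
    Homog-⊛ {s} {t} {A} {B} hA hB = homog λ n n≢s+t → Σ≤-zero n (term≈0 n n≢s+t)
      where
      term≈0 : ∀ n → ¬ (n ≡ₘ s ℕ.+ t) → ∀ i → i ≤ n → A i * B (n ∸ i) ≈ 0#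
      term≈0 n n≢s+t i i≤n with i ≡ₘ? s | (n ∸ i) ≡ₘ? t
      ... | no i≢s | _        = trans (*-cong (vanish hA i i≢s) refl) (zeroˡ _)
      ... | yes _  | no n-i≢t = trans (*-cong refl (vanish hB (n ∸ i) n-i≢t)) (zeroʳ _)
      ... | yes i≡s | yes n-i≡t =
        contradiction (≡.subst (_≡ₘ s ℕ.+ t) (ℕ.m+[n∸m]≡n i≤n) (+-cong-≡ₘ i≡s n-i≡t)) n≢s+t

    Homog-pow : ∀ {s A} k → Homog s A → Homog (k ℕ.* s) (pow A k)
    Homog-pow zero    hA = Homog-const 1#
    Homog-pow (suc k) hA = Homog-⊛ hA (Homog-pow k hA)

    Homog-Π : ∀ n {s : Fin n → ℕ} {F : Fin n → Series} → (∀ i → Homog (s i) (F i)) → Homog (sum s) (Π n F)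
    Homog-Π zero    hF = Homog-const 1#
    Homog-Π (suc n) hF = Homog-⊛ (hF Fin.zero) (Homog-Π n (λ i → hF (Fin.suc i)))

    Homog-shift : ∀ {s A} → Homog (suc s) A → Homog s (shift A)
    Homog-shift hA = homog λ n n≢s → vanish hA (suc n) (λ sn≡ss → n≢s (suc-injective-≡ₘ sn≡ss))

    Homog-∘ : ∀ {s A H} → Homog 1 H → Homog s A → Homog s (A ∘ₛ H)
    Homog-∘ {s} {A} {H} hH hA = homog λ n n≢s → Σ≤-zero n (λ k _ → term≈0 n n≢s k)
      where
      term≈0 : ∀ n → ¬ (n ≡ₘ s) → ∀ k → A k * pow H k n ≈ 0#
      term≈0 n n≢s k with k ≡ₘ? s
      ... | no k≢s  = trans (*-cong (vanish hA k k≢s) refl) (zeroˡ _)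
      ... | yes k≡s = trans (*-cong refl (vanish (Homog-pow k hH) n n≢k)) (zeroʳ _)
        where
        n≢k : ¬ (n ≡ₘ k ℕ.* 1)
        n≢k n≡k = n≢s (≡ₘ-trans n≡k (≡ₘ-trans (≡ₘ-reflexive (ℕ.*-identityʳ k)) k≡s))

    Homog-∘₀ : ∀ {A H} → Homog 0 H → Homog 0 (A ∘ₛ H)
    Homog-∘₀ {A} {H} hH = homog λ n n≢0 → Σ≤-zero n λ k _ →
      trans (*-cong refl (vanish (Homog-pow k hH) n (λ n≡0 → n≢0 (≡ₘ-trans n≡0 (≡ₘ-reflexive (ℕ.*-zeroʳ k))))))
            (zeroʳ _)

    Homog-inv : ∀ {A} → Homog 0 A → Homog 0 (inv A)
    Homog-inv hA = Homog-• _ (Homog-∘₀ (Homog-⊖ (Homog-const 1#) (Homog-• _ hA)))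

    Homog-÷ₜ : ∀ {s A C} → Homog (suc s) A → Homog 1 C → Homog s (A ÷ₜ C)
    Homog-÷ₜ {s} hA hC = Homog-≡ (ℕ.+-identityʳ s) (Homog-⊛ (Homog-shift hA) (Homog-inv (Homog-shift hC)))

    ∣⇒≡ₘ0 : ∀ {n} → ℓ ∣ n → n ≡ₘ 0
    ∣⇒≡ₘ0 {n} ℓ∣n = mod-≡ (≡.trans (n∣m⇒m%n≡0 n ℓ ℓ∣n) (≡.sym (m*n%n≡0 0 ℓ)))

    InPowℓ⇒Homog : ∀ {A} → InPowℓ ℓ A → Homog 0 A
    InPowℓ⇒Homog A∈ = homog λ n n≢0 → A∈ n (λ ℓ∣n → n≢0 (∣⇒≡ₘ0 ℓ∣n))

    InTPowℓ⇒Homog : ∀ {A} → InTPowℓ ℓ A → Homog 1 A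
    InTPowℓ⇒Homog (A0≈0 , A∈) = homog λ where
      zero    _    → A0≈0
      (suc n) n≢0 → A∈ n (λ ℓ∣n → n≢0 (+-cong-≡ₘ {1} {n} {1} {0} ≡ₘ-refl (∣⇒≡ₘ0 ℓ∣n)))

    pow-Homog-vanish : ∀ {H} → Homog 1 H → ∀ {j k} → ¬ (j ≡ₘ k) → pow H k j ≈ 0#
    pow-Homog-vanish hH {j} {k} j≢k =
      vanish (Homog-pow k hH) j (λ j≡k*1 → j≢k (≡ₘ-trans j≡k*1 (≡ₘ-reflexive (ℕ.*-identityʳ k))))

    component : ℕ → Series → Series
    component s A n with n ≡ₘ? s
    ... | yes _ = A n
    ... | no  _ = 0#

    component-≡ₘ : ∀ s A {n} → n ≡ₘ s → component s A n ≈ A n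
    component-≡ₘ s A {n} n≡s with n ≡ₘ? s
    ... | yes _   = refl
    ... | no  n≢s = contradiction n≡s n≢s

    component-≢ : ∀ s A {n} → ¬ (n ≡ₘ s) → component s A n ≈ 0#
    component-≢ s A {n} n≢s with n ≡ₘ? s
    ... | yes n≡s = contradiction n≡s n≢s
    ... | no  _   = refl

    Homog-component : ∀ s A → Homog s (component s A)
    Homog-component s A = homog λ _ → component-≢ s A

    component-Homog : ∀ {s t A} → Homog s A → ¬ (t ≡ₘ s) → component t A ≋ 𝟘
    component-Homog {s} {t} {A} hA t≢s n with n ≡ₘ? t
    ... | yes n≡t = vanish hA n (λ n≡s → t≢s (≡ₘ-trans (≡ₘ-sym n≡t) n≡s))
    ... | no  _   = refl

    ∘-component : ∀ s A {H} → Homog 1 H → component s A ∘ₛ H ≋ component s (A ∘ₛ H)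
    ∘-component s A {H} hH j with j ≡ₘ? s
    ... | yes j≡s = Σ≤-cong j term
      where
      term : ∀ k → component s A k * pow H k j ≈ A k * pow H k j
      term k with k ≡ₘ? s
      ... | yes _   = refl
      ... | no  k≢s = trans (*-cong refl H^k≈0) (trans (zeroʳ _) (sym (trans (*-cong refl H^k≈0) (zeroʳ _))))
        where H^k≈0 = pow-Homog-vanish hH (λ j≡k → k≢s (≡ₘ-trans (≡ₘ-sym j≡k) j≡s))
    ... | no  j≢s = Σ≤-zero j (λ k _ → term k)
      where
      term : ∀ k → component s A k * pow H k j ≈ 0#
      term k with k ≡ₘ? s
      ... | yes k≡s = trans (*-cong refl (pow-Homog-vanish hH (λ j≡k → j≢s (≡ₘ-trans j≡k k≡s)))) (zeroʳ _)
      ... | no  _   = zeroˡ _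

    Homog-∘⁻¹ : ∀ {s A H H̄} → Homog 1 H → H 0 ≈ 0# → H̄ 0 ≈ 0# → H ∘ₛ H̄ ≋ X →
                Homog s (A ∘ₛ H) → Homog s A
    Homog-∘⁻¹ {s} {A} {H} {H̄} hH H0≈0 H̄0≈0 H∘H̄≋X hAH = homog λ n n≢s →
      trans (sym (component-≡ₘ n A ≡ₘ-refl)) (component≋𝟘 n≢s n)
      where
      component≋𝟘 : ∀ {t} → ¬ (t ≡ₘ s) → component t A ≋ 𝟘
      component≋𝟘 {t} t≢s = begin
        component t A                      ≈⟨ ∘-X (component t A) ⟨
        component t A ∘ₛ X                 ≈⟨ ∘-congʳ (component t A) H∘H̄≋X ⟨
        component t A ∘ₛ (H ∘ₛ H̄)          ≈⟨ ∘-assoc (component t A) H H̄ H0≈0 H̄0≈0 ⟨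
        (component t A ∘ₛ H) ∘ₛ H̄          ≈⟨ ∘-congˡ H̄ (∘-component t A hH) ⟩
        component t (A ∘ₛ H) ∘ₛ H̄          ≈⟨ ∘-congˡ H̄ (component-Homog hAH t≢s) ⟩
        𝟘 ∘ₛ H̄                             ≈⟨ 𝟘-∘ H̄ ⟩
        𝟘                                  ∎
        where open ≋-Reasoning

    -- Write V = W + E with W its degree-0 component. Then V^(k+1) - W^(k+1) = E·S where S(0) = (k+1)·V(0)^k
    -- is nonzero in characteristic 0, so the lowest nonzero coefficient of E would survive in E·S ∈ K[[t^ℓ]].
    Homog-root : CharZero → ∀ {U V} k → Homog 0 U → pow V (suc k) ≋ U → ¬ (V 0 ≈ 0#) → Homog 0 V
    Homog-root charZero {U} {V} k hU V^k+1≋U V0≉0 = homog λ n n≢0 →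
      trans (sym (trans (+-cong refl (trans (-‿cong (component-≢ 0 V n≢0)) -0#≈0#)) (+-identityʳ _))) (E≋𝟘 n)
      where
      W : Series
      W = component 0 V
      E : Series
      E = V ⊖ W

      S : ℕ → Series
      S zero    = 𝟘
      S (suc j) = pow W j ⊕ V ⊛ S j

      pow-V : ∀ j → pow V j ≋ pow W j ⊕ E ⊛ S j
      pow-V zero    n = sym (trans (+-cong refl (trans (⊛-comm E 𝟘 n) (𝟘-⊛ E n))) (+-identityʳ _))
      pow-V (suc j) = begin
        V ⊛ pow V j
          ≈⟨ ⊛-cong (≋.refl {V}) (pow-V j) ⟩
        V ⊛ (pow W j ⊕ E ⊛ S j)
          ≈⟨ ⊛-cong V≋W⊕E (≋.refl {pow W j ⊕ E ⊛ S j}) ⟩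
        (W ⊕ E) ⊛ (pow W j ⊕ E ⊛ S j)
          ≈⟨ solve 4 (λ w e p s → (w :+ e) :* (p :+ e :* s) := w :* p :+ e :* (p :+ (w :+ e) :* s))
                                                     ≋.refl W E (pow W j) (S j) ⟩
        W ⊛ pow W j ⊕ E ⊛ (pow W j ⊕ (W ⊕ E) ⊛ S j)
          ≈⟨ ⊕-cong (≋.refl {W ⊛ pow W j}) (⊛-cong (≋.refl {E})
               (⊕-cong (≋.refl {pow W j}) (⊛-cong (≋.sym V≋W⊕E) (≋.refl {S j})))) ⟩
        W ⊛ pow W j ⊕ E ⊛ S (suc j)        ∎
        where
        open ≋-Reasoning
        open S-Solver using (solve; _:=_; _:+_; _:*_)
        V≋W⊕E : V ≋ W ⊕ E
        V≋W⊕E n = sym (x+[y-x]≈y (W n) (V n))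

      S-at-0 : ∀ j → S (suc j) 0 ≈ ι (suc j) * pow V j 0
      S-at-0 zero    = trans (+-cong refl (zeroʳ (V 0))) (sym (*-identityʳ _))
      S-at-0 (suc j) = begin
        pow W (suc j) 0 + V 0 * S (suc j) 0
          ≈⟨ +-cong (pow-at-0-cong W V (suc j) (component-≡ₘ 0 V ≡ₘ-refl)) (*-cong refl (S-at-0 j)) ⟩
        V 0 * pow V j 0 + V 0 * (ι (suc j) * pow V j 0)
          ≈⟨ solve 3 (λ v i p → v :* p :+ v :* (i :* p) := (con 1 :+ i) :* (v :* p)) refl (V 0) (ι (suc j)) (pow V j 0) ⟩
        (1# + ι (suc j)) * (V 0 * pow V j 0)            ∎
        where
        open ≈-Reasoning
        open K-Solver using (solve; _:=_; _:+_; _:*_; con)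

      S0≉0 : ¬ (S (suc k) 0 ≈ 0#)
      S0≉0 S0≈0 = x*y≉0 (charZero k) (pow-≉0 V k V0≉0) (trans (sym (S-at-0 k)) S0≈0)

      E⊛S-vanish : ∀ n → ¬ (n ≡ₘ 0) → (E ⊛ S (suc k)) n ≈ 0#
      E⊛S-vanish n n≢0 = begin
        (E ⊛ S (suc k)) n
          ≈⟨ +-identityˡ _ ⟨
        0# + (E ⊛ S (suc k)) n
          ≈⟨ +-cong (vanish (Homog-≡ (ℕ.*-zeroʳ (suc k)) (Homog-pow (suc k) (Homog-component 0 V))) n n≢0) refl ⟨
        pow W (suc k) n + (E ⊛ S (suc k)) n
          ≈⟨ pow-V (suc k) n ⟨
        pow V (suc k) n
          ≈⟨ V^k+1≋U n ⟩
        U n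
          ≈⟨ vanish hU n n≢0 ⟩
        0#                                    ∎
        where open ≈-Reasoning

      E≋𝟘 : E ≋ 𝟘
      E≋𝟘 n = <-rec (λ n → E n ≈ 0#) step n
        where
        step : ∀ n → (∀ {j} → j < n → E j ≈ 0#) → E n ≈ 0#
        step n IH = by-cases (n ≡ₘ? 0)
          where
          by-cases : Dec (n ≡ₘ 0) → E n ≈ 0#
          by-cases (yes n≡0) = trans (+-cong refl (-‿cong (component-≡ₘ 0 V n≡0))) (-‿inverseʳ (V n))
          by-cases (no  n≢0) = x*y≈0⇒x≈0 S0≉0 (begin
            E n * S (suc k) 0       ≈⟨ *-comm _ _ ⟩
            S (suc k) 0 * E n       ≈⟨ ⊛-leading (S (suc k)) E n (λ j j<n → IH j<n) ⟨
            (S (suc k) ⊛ E) n       ≈⟨ ⊛-comm (S (suc k)) E n ⟩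
            (E ⊛ S (suc k)) n       ≈⟨ E⊛S-vanish n n≢0 ⟩
            0#                      ∎)
            where open ≈-Reasoning

  -- Multiple almost-Riordan arrays

  module Arrays (m : ℕ) where
    open ColumnExponents m
    open Residues ℓ

    last : Fin ℓ
    last = fromℕ (suc m)

    Homog-1-at-0 : ∀ {A} → Homog 1 A → A 0 ≈ 0#
    Homog-1-at-0 hA = vanish hA 0 (λ { (mod-≡ ()) })

    MAR-cong : ∀ {B B′ G G′} {F F′ : Fin ℓ → Series} → B ≋ B′ → G ≋ G′ → (∀ i → F i ≋ F′ i) →
               MAR m B G F ≋ᴹ MAR m B′ G′ F′
    MAR-cong B≋B′ G≋G′ F≋F′ n zero    = B≋B′ n
    MAR-cong B≋B′ G≋G′ F≋F′ n (suc k) =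
      ⊛-cong (⊛-cong (≋.refl {X}) G≋G′) (Π-cong ℓ (λ i → pow-cong (expo m (suc k) i) (F≋F′ i))) n

    column-Π : ∀ (F : Fin ℓ → Series) k →
               Π ℓ (λ i → pow (F i) (expo m (suc k) i)) ≋ Π< ℓ (k % ℓ) F ⊛ pow (Π ℓ F) (k / ℓ)
    column-Π F k = begin
      Π ℓ (λ i → pow (F i) (expo m (suc k) i))
        ≈⟨ Π-cong ℓ (λ i → pow-congʳ (F i) (expo-suc k i)) ⟩
      Π ℓ (λ i → pow (F i) (χ< (k % ℓ) i ℕ.+ k / ℓ))
        ≈⟨ Π-cong ℓ (λ i → pow-homo-+ (F i) (χ< (k % ℓ) i) (k / ℓ)) ⟩
      Π ℓ (λ i → pow (F i) (χ< (k % ℓ) i) ⊛ pow (F i) (k / ℓ))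
        ≈⟨ Π-distrib-⊛ ℓ (λ i → pow (F i) (χ< (k % ℓ) i)) (λ i → pow (F i) (k / ℓ)) ⟩
      Π< ℓ (k % ℓ) F ⊛ Π ℓ (λ i → pow (F i) (k / ℓ))
        ≈⟨ ⊛-cong (≋.refl {Π< ℓ (k % ℓ) F}) (Π-pow ℓ F (k / ℓ)) ⟩
      Π< ℓ (k % ℓ) F ⊛ pow (Π ℓ F) (k / ℓ)                              ∎
      where open ≋-Reasoning

    Homog-column : ∀ {C D P} k → Homog 0 D → (∀ i → Homog 1 (P i)) → Homog (suc k) (column m C D P (suc k))
    Homog-column {P = P} k hD hP =
      Homog-≡ exponent (Homog-⊛ (Homog-⊛ Homog-X hD) (Homog-Π ℓ (λ i → Homog-pow (expo m (suc k) i) (hP i))))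
      where
      exponent : 1 ℕ.+ 0 ℕ.+ sum (λ i → expo m (suc k) i ℕ.* 1) ≡ suc k
      exponent = ≡.cong suc (≡.trans (sum-cong-≗ {ℓ} (λ i → ℕ.*-identityʳ (expo m (suc k) i))) (sum-expo-suc k))

    pow-X≈Id : ∀ j n → pow X j n ≈ Id n j
    pow-X≈Id zero    zero    = refl
    pow-X≈Id zero    (suc n) = refl
    pow-X≈Id (suc j) zero    = X⊛-at-0 (pow X j)
    pow-X≈Id (suc j) (suc n) = trans (shift-X⊛ (pow X j) n) (pow-X≈Id j n)

    MAR-Id : ∀ {B G} {F : Fin ℓ → Series} → B ≋ const 1# → G ≋ const 1# → (∀ i → F i ≋ X) → MAR m B G F ≋ᴹ Id
    MAR-Id B≋1 G≋1 F≋X n k = trans (MAR-cong B≋1 G≋1 F≋X n k) (MAR-1-1-X n k)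
      where
      MAR-1-1-X : MAR m (const 1#) (const 1#) (λ _ → X) ≋ᴹ Id
      MAR-1-1-X zero    zero    = refl
      MAR-1-1-X (suc n) zero    = refl
      MAR-1-1-X n       (suc k) = trans (column≋X^k+1 n) (pow-X≈Id (suc k) n)
        where
        column≋X^k+1 : X ⊛ const 1# ⊛ Π ℓ (λ i → pow X (expo m (suc k) i)) ≋ pow X (suc k)
        column≋X^k+1 = ⊛-cong (⊛-identityʳ X)
          (≋.trans (Π-pow-sum ℓ X (expo m (suc k))) (pow-congʳ X (sum-expo-suc k)))

    module Decomposition (B G : Series) (F : Fin ℓ → Series) (H : Series)
      (H0≈0 : H 0 ≈ 0#) (H1≉0 : ¬ (H 1 ≈ 0#)) (F0≈0 : ∀ i → F i 0 ≈ 0#) (H^ℓ≋ΠF : pow H ℓ ≋ Π ℓ F) where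

      Ĥ : Series
      Ĥ = shift H
      Ĥ⁻¹ : Series
      Ĥ⁻¹ = inv Ĥ

      F̂ : Fin ℓ → Series
      F̂ i = shift (F i)

      pow-H : ∀ k → pow H k ≋ pow X k ⊛ pow Ĥ k
      pow-H k = ≋.trans (pow-cong k (X⊛-shift H H0≈0)) (pow-distrib-⊛ X Ĥ k)

      Π-F̂ : Π ℓ F̂ ≋ pow Ĥ ℓ
      Π-F̂ = ≋.sym (shift-pow-Π ℓ {H} {F} H0≈0 F0≈0 H^ℓ≋ΠF)

      F̂-≉0 : ∀ i → ¬ (F̂ i 0 ≈ 0#)
      F̂-≉0 = Π-≉0⇒≉0 ℓ F̂ (λ ΠF̂0≈0 → pow-≉0 Ĥ ℓ H1≉0 (trans (sym (Π-F̂ 0)) ΠF̂0≈0))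

      Π-F̂-Ĥ⁻¹ : Π ℓ F̂ ⊛ pow Ĥ⁻¹ ℓ ≋ const 1#
      Π-F̂-Ĥ⁻¹ = ≋.trans (⊛-cong Π-F̂ (≋.refl {pow Ĥ⁻¹ ℓ})) (pow-inverse Ĥ ℓ H1≉0)

      Π<-÷ₜH : ∀ r → r ≤ ℓ → Π< ℓ r (λ i → F i ÷ₜ H) ≋ Π< ℓ r F̂ ⊛ pow Ĥ⁻¹ r
      Π<-÷ₜH r r≤ℓ = ≋.trans (Π<-distrib-⊛ ℓ r F̂ (λ _ → Ĥ⁻¹)) (⊛-cong (≋.refl {Π< ℓ r F̂}) (Π<-const ℓ r Ĥ⁻¹ r≤ℓ))

      -- Column qℓ + r + 1 of the array is t G F₁⋯F_r (F₁⋯F_ℓ)^q = H^(qℓ+r+1) · W r.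
      W : ℕ → Series
      W r = G ⊛ Π< ℓ r (λ i → F i ÷ₜ H) ⊛ Ĥ⁻¹

      column-decomposition : ∀ k → column m B G F (suc k) ≋ pow H (suc k) ⊛ W (k % ℓ)
      column-decomposition k = begin
        X ⊛ G ⊛ Π ℓ (λ i → pow (F i) (expo m (suc k) i))
          ≈⟨ ⊛-cong (≋.refl {X ⊛ G}) (column-Π F k) ⟩
        X ⊛ G ⊛ (Π< ℓ r F ⊛ pow (Π ℓ F) q)
          ≈⟨ ⊛-cong (≋.refl {X ⊛ G}) (⊛-cong Π<F≋ (pow-cong q (≋.sym H^ℓ≋ΠF))) ⟩
        X ⊛ G ⊛ ((pow X r ⊛ Π< ℓ r F̂) ⊛ pow (pow H ℓ) q)
          ≈⟨ ⊛-identityʳ-≋ _ (pow-inverse Ĥ (suc r) H1≉0) ⟨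
        X ⊛ G ⊛ ((pow X r ⊛ Π< ℓ r F̂) ⊛ pow (pow H ℓ) q) ⊛ (pow Ĥ (suc r) ⊛ pow Ĥ⁻¹ (suc r))
          ≈⟨ solve 9 (λ x g xr pf hq h hr i ir →
                        x :* g :* ((xr :* pf) :* hq) :* ((h :* hr) :* (i :* ir))
                        := ((x :* xr) :* (h :* hr) :* hq) :* (g :* (pf :* ir) :* i))
                     ≋.refl X G (pow X r) (Π< ℓ r F̂) (pow (pow H ℓ) q) Ĥ (pow Ĥ r) Ĥ⁻¹ (pow Ĥ⁻¹ r) ⟩
        (pow X (suc r) ⊛ pow Ĥ (suc r) ⊛ pow (pow H ℓ) q) ⊛ (G ⊛ (Π< ℓ r F̂ ⊛ pow Ĥ⁻¹ r) ⊛ Ĥ⁻¹)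
          ≈⟨ ⊛-cong H^k+1≋ (⊛-cong (⊛-cong (≋.refl {G}) (≋.sym (Π<-÷ₜH r r≤ℓ))) (≋.refl {Ĥ⁻¹})) ⟩
        pow H (suc k) ⊛ W r ∎
        where
        open ≋-Reasoning
        open S-Solver using (solve; _:=_; _:*_)
        r : ℕ
        r = k % ℓ
        q : ℕ
        q = k / ℓ
        r≤ℓ : r ≤ ℓ
        r≤ℓ = <⇒≤ (m%n<n k ℓ)
        Π<F≋ : Π< ℓ r F ≋ pow X r ⊛ Π< ℓ r F̂
        Π<F≋ = ≋.trans (Π-cong ℓ (λ i → pow-cong (χ< r i) (X⊛-shift (F i) (F0≈0 i))))
                 (≋.trans (Π<-distrib-⊛ ℓ r (λ _ → X) F̂) (⊛-cong (Π<-const ℓ r X r≤ℓ) (≋.refl {Π< ℓ r F̂})))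
        H^k+1≋ : pow X (suc r) ⊛ pow Ĥ (suc r) ⊛ pow (pow H ℓ) q ≋ pow H (suc k)
        H^k+1≋ = begin
          pow X (suc r) ⊛ pow Ĥ (suc r) ⊛ pow (pow H ℓ) q
            ≈⟨ ⊛-cong (≋.sym (pow-H (suc r))) (pow-pow H ℓ q) ⟩
          pow H (suc r) ⊛ pow H (ℓ ℕ.* q)
            ≈⟨ pow-homo-+ H (suc r) (ℓ ℕ.* q) ⟨
          pow H (suc r ℕ.+ ℓ ℕ.* q)
            ≈⟨ pow-congʳ H (≡.cong suc (≡.sym (k≡k%ℓ+ℓ*[k/ℓ] k))) ⟩
          pow H (suc k)                                    ∎

      W-last : W (suc m) ≋ (X ⊛ G) ÷ₜ F last
      W-last = begin
        G ⊛ Π< ℓ (suc m) (λ i → F i ÷ₜ H) ⊛ Ĥ⁻¹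
          ≈⟨ ⊛-cong (⊛-cong (≋.refl {G}) (Π<-÷ₜH (suc m) (ℕ.n≤1+n (suc m)))) (≋.refl {Ĥ⁻¹}) ⟩
        G ⊛ (Π<F̂ ⊛ pow Ĥ⁻¹ (suc m)) ⊛ Ĥ⁻¹
          ≈⟨ ⊛-assoc G (Π<F̂ ⊛ pow Ĥ⁻¹ (suc m)) Ĥ⁻¹ ⟩
        G ⊛ ((Π<F̂ ⊛ pow Ĥ⁻¹ (suc m)) ⊛ Ĥ⁻¹)
          ≈⟨ ⊛-cong (shift-X⊛ G) (≋.sym (inv-unique (F̂ last) ((Π<F̂ ⊛ pow Ĥ⁻¹ (suc m)) ⊛ Ĥ⁻¹)
               (F̂-≉0 last) F̂-last-inverse)) ⟨
        shift (X ⊛ G) ⊛ inv (F̂ last)               ∎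
        where
        open ≋-Reasoning
        open S-Solver using (solve; _:=_; _:*_)
        Π<F̂ : Series
        Π<F̂ = Π< ℓ (suc m) F̂
        F̂-last-inverse : F̂ last ⊛ ((Π<F̂ ⊛ pow Ĥ⁻¹ (suc m)) ⊛ Ĥ⁻¹) ≋ const 1#
        F̂-last-inverse = begin
          F̂ last ⊛ ((Π<F̂ ⊛ pow Ĥ⁻¹ (suc m)) ⊛ Ĥ⁻¹)
            ≈⟨ solve 4 (λ f a b c → f :* ((a :* b) :* c) := (a :* f) :* (c :* b))
                                                              ≋.refl (F̂ last) Π<F̂ (pow Ĥ⁻¹ (suc m)) Ĥ⁻¹ ⟩
          (Π<F̂ ⊛ F̂ last) ⊛ pow Ĥ⁻¹ ℓ
            ≈⟨ ⊛-cong (Π<-last (suc m) F̂) (≋.refl {pow Ĥ⁻¹ ℓ}) ⟩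
          Π ℓ F̂ ⊛ pow Ĥ⁻¹ ℓ
            ≈⟨ Π-F̂-Ĥ⁻¹ ⟩
          const 1#                                    ∎

      MAR-apply : ∀ A s → Homog (suc s) A → A 0 ≈ 0# →
                  ∀ n → Σ≤ n (λ j → MAR m B G F n j * A j) ≈ ((A ∘ₛ H) ⊛ W (s % ℓ)) n
      MAR-apply A s hA A0≈0 = Σ≤-columns-∘ (column m B G F) A H (W (s % ℓ)) H0≈0 decomposes
        where
        decomposes : ∀ j → A j ≈ 0# ⊎ column m B G F j ≋ pow H j ⊛ W (s % ℓ)
        decomposes zero = inj₁ A0≈0
        decomposes (suc j) with suc j ≡ₘ? suc s
        ... | no  j+1≢s+1 = inj₁ (vanish hA (suc j) j+1≢s+1)
        ... | yes j+1≡s+1 = inj₂ (≡.subst (λ r → column m B G F (suc j) ≋ pow H (suc j) ⊛ W r)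
                                          (%-≡ (suc-injective-≡ₘ j+1≡s+1)) (column-decomposition j))

      module Product (C D : Series) (P : Fin ℓ → Series)
        (hC : Homog 0 C) (hD : Homog 0 D) (hP : ∀ i → Homog 1 (P i)) where

        B′ : Series
        B′ = (C 0 • B) ⊕ ((X ⊛ G) ÷ₜ F last) ⊛ ((C ∘ₛ H) ⊖ const (C 0))

        G′ : Series
        G′ = G ⊛ (D ∘ₛ H)

        F′ : Fin ℓ → Series
        F′ i = (F i ÷ₜ H) ⊛ (P i ∘ₛ H)

        product-column-0 : ∀ n → Σ≤ n (λ j → MAR m B G F n j * C j) ≈ B′ n
        product-column-0 n = begin
          Σ≤ n (λ j → MAR m B G F n j * C j)
            ≈⟨ Σ≤-cong n (λ j → trans (*-cong refl (sym (x+[y-x]≈y (const (C 0) j) (C j)))) (distribˡ _ _ _)) ⟩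
          Σ≤ n (λ j → MAR m B G F n j * const (C 0) j + MAR m B G F n j * C′ j)
            ≈⟨ Σ≤-distrib-+ n _ _ ⟩
          Σ≤ n (λ j → MAR m B G F n j * const (C 0) j) + Σ≤ n (λ j → MAR m B G F n j * C′ j)
            ≈⟨ +-cong (Σ≤-truncate n 0 _ z≤n (λ { (suc j) _ _ → zeroʳ _ })) (MAR-apply C′ (suc m) hC′ (-‿inverseʳ (C 0)) n) ⟩
          B n * C 0 + ((C′ ∘ₛ H) ⊛ W (suc m % ℓ)) n
            ≈⟨ +-cong (*-comm _ _) (⊛-comm (C′ ∘ₛ H) (W (suc m % ℓ)) n) ⟩
          C 0 * B n + (W (suc m % ℓ) ⊛ (C′ ∘ₛ H)) n
            ≡⟨ ≡.cong (λ r → C 0 * B n + (W r ⊛ (C′ ∘ₛ H)) n) (m<n⇒m%n≡m (ℕ.n<1+n (suc m))) ⟩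
          C 0 * B n + (W (suc m) ⊛ (C′ ∘ₛ H)) n
            ≈⟨ +-cong refl (⊛-cong W-last C′∘H n) ⟩
          B′ n ∎
          where
          open ≈-Reasoning
          C′ : Series
          C′ = C ⊖ const (C 0)
          hC′ : Homog (suc (suc m)) C′
          hC′ = Homog-≡ₘ (≡ₘ-sym (+ℓ-≡ₘ 0)) (Homog-⊖ hC (Homog-const (C 0)))
          C′∘H : C′ ∘ₛ H ≋ (C ∘ₛ H) ⊖ const (C 0)
          C′∘H = ≋.trans (∘-homo-⊖ C (const (C 0)) H) (⊖-cong (≋.refl {C ∘ₛ H}) (const-∘ (C 0) H))

        Π-F′ : Π ℓ F′ ≋ Π ℓ P ∘ₛ H
        Π-F′ = begin
          Π ℓ (λ i → (F̂ i ⊛ Ĥ⁻¹) ⊛ (P i ∘ₛ H))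
            ≈⟨ Π-distrib-⊛ ℓ (λ i → F̂ i ⊛ Ĥ⁻¹) (λ i → P i ∘ₛ H) ⟩
          Π ℓ (λ i → F̂ i ⊛ Ĥ⁻¹) ⊛ Π ℓ (λ i → P i ∘ₛ H)
            ≈⟨ ⊛-cong (Π-distrib-⊛ ℓ F̂ (λ _ → Ĥ⁻¹)) (≋.sym (∘-homo-Π ℓ P H H0≈0)) ⟩
          (Π ℓ F̂ ⊛ Π ℓ (λ _ → Ĥ⁻¹)) ⊛ (Π ℓ P ∘ₛ H)
            ≈⟨ ⊛-cong (⊛-cong (≋.refl {Π ℓ F̂}) (Π-const ℓ Ĥ⁻¹)) (≋.refl {Π ℓ P ∘ₛ H}) ⟩
          (Π ℓ F̂ ⊛ pow Ĥ⁻¹ ℓ) ⊛ (Π ℓ P ∘ₛ H)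
            ≈⟨ ⊛-cong Π-F̂-Ĥ⁻¹ (≋.refl {Π ℓ P ∘ₛ H}) ⟩
          const 1# ⊛ (Π ℓ P ∘ₛ H)
            ≈⟨ ⊛-identityˡ (Π ℓ P ∘ₛ H) ⟩
          Π ℓ P ∘ₛ H                                        ∎
          where open ≋-Reasoning

        column-∘ : ∀ k → column m C D P (suc k) ∘ₛ H
                         ≋ H ⊛ (D ∘ₛ H) ⊛ (Π< ℓ (k % ℓ) (λ i → P i ∘ₛ H) ⊛ pow (Π ℓ P ∘ₛ H) (k / ℓ))
        column-∘ k = begin
          (X ⊛ D ⊛ Π ℓ (λ i → pow (P i) (expo m (suc k) i))) ∘ₛ H
            ≈⟨ ∘-congˡ H (⊛-cong (≋.refl {X ⊛ D}) (column-Π P k)) ⟩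
          (X ⊛ D ⊛ (Π< ℓ r P ⊛ pow (Π ℓ P) q)) ∘ₛ H
            ≈⟨ ∘-homo-⊛ (X ⊛ D) (Π< ℓ r P ⊛ pow (Π ℓ P) q) H H0≈0 ⟩
          (X ⊛ D) ∘ₛ H ⊛ (Π< ℓ r P ⊛ pow (Π ℓ P) q) ∘ₛ H
            ≈⟨ ⊛-cong (∘-homo-⊛ X D H H0≈0) (∘-homo-⊛ (Π< ℓ r P) (pow (Π ℓ P) q) H H0≈0) ⟩
          X ∘ₛ H ⊛ D ∘ₛ H ⊛ (Π< ℓ r P ∘ₛ H ⊛ pow (Π ℓ P) q ∘ₛ H)
            ≈⟨ ⊛-cong (⊛-cong (X-∘ H H0≈0) (≋.refl {D ∘ₛ H}))
                      (⊛-cong (≋.trans (∘-homo-Π ℓ (λ i → pow (P i) (χ< r i)) H H0≈0)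
                                       (Π-cong ℓ (λ i → ∘-homo-pow (P i) H (χ< r i) H0≈0)))
                              (∘-homo-pow (Π ℓ P) H q H0≈0)) ⟩
          H ⊛ (D ∘ₛ H) ⊛ (Π< ℓ r (λ i → P i ∘ₛ H) ⊛ pow (Π ℓ P ∘ₛ H) q) ∎
          where
          open ≋-Reasoning
          r : ℕ
          r = k % ℓ
          q : ℕ
          q = k / ℓ

        product-column-suc : ∀ k → (column m C D P (suc k) ∘ₛ H) ⊛ W (k % ℓ) ≋ column m B′ G′ F′ (suc k)
        product-column-suc k = begin
          (column m C D P (suc k) ∘ₛ H) ⊛ W r
            ≈⟨ ⊛-cong (column-∘ k) (≋.refl {W r}) ⟩
          (H ⊛ (D ∘ₛ H) ⊛ (Π<PH ⊛ pow ΠP∘H q)) ⊛ (G ⊛ Π<F/H ⊛ Ĥ⁻¹)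
            ≈⟨ ⊛-cong (⊛-cong (⊛-cong (X⊛-shift H H0≈0) (≋.refl {D ∘ₛ H})) (≋.refl {Π<PH ⊛ pow ΠP∘H q}))
                 (≋.refl {G ⊛ Π<F/H ⊛ Ĥ⁻¹}) ⟩
          ((X ⊛ Ĥ) ⊛ (D ∘ₛ H) ⊛ (Π<PH ⊛ pow ΠP∘H q)) ⊛ (G ⊛ Π<F/H ⊛ Ĥ⁻¹)
            ≈⟨ solve 8 (λ x h dh pp pq g pf i → ((x :* h) :* dh :* (pp :* pq)) :* (g :* pf :* i)
                                                := (x :* (g :* dh) :* ((pf :* pp) :* pq)) :* (h :* i))
                       ≋.refl X Ĥ (D ∘ₛ H) Π<PH (pow ΠP∘H q) G Π<F/H Ĥ⁻¹ ⟩
          (X ⊛ (G ⊛ (D ∘ₛ H)) ⊛ ((Π<F/H ⊛ Π<PH) ⊛ pow ΠP∘H q)) ⊛ (Ĥ ⊛ Ĥ⁻¹)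
            ≈⟨ ⊛-identityʳ-≋ _ (inv-inverseʳ Ĥ H1≉0) ⟩
          X ⊛ (G ⊛ (D ∘ₛ H)) ⊛ ((Π<F/H ⊛ Π<PH) ⊛ pow ΠP∘H q)
            ≈⟨ ⊛-cong (≋.refl {X ⊛ (G ⊛ (D ∘ₛ H))})
                      (⊛-cong (≋.sym (Π<-distrib-⊛ ℓ r (λ i → F i ÷ₜ H) (λ i → P i ∘ₛ H))) (pow-cong q (≋.sym Π-F′))) ⟩
          X ⊛ G′ ⊛ (Π< ℓ r F′ ⊛ pow (Π ℓ F′) q)
            ≈⟨ ⊛-cong (≋.refl {X ⊛ G′}) (column-Π F′ k) ⟨
          column m B′ G′ F′ (suc k) ∎
          where
          open ≋-Reasoning
          open S-Solver using (solve; _:=_; _:*_)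
          r : ℕ
          r = k % ℓ
          q : ℕ
          q = k / ℓ
          Π<PH : Series
          Π<PH = Π< ℓ r (λ i → P i ∘ₛ H)
          ΠP∘H : Series
          ΠP∘H = Π ℓ P ∘ₛ H
          Π<F/H : Series
          Π<F/H = Π< ℓ r (λ i → F i ÷ₜ H)

        MAR-⊗ : MAR m B G F ⊗ MAR m C D P ≋ᴹ MAR m B′ G′ F′
        MAR-⊗ n zero    = product-column-0 n
        MAR-⊗ n (suc k) = trans (MAR-apply (column m C D P (suc k)) k (Homog-column {C} k hD hP) column-at-0 n)
                                (product-column-suc k n)
          where
          column-at-0 : column m C D P (suc k) 0 ≈ 0#
          column-at-0 = trans (*-cong (zeroˡ _) refl) (zeroˡ _)

    module Inverse (charZero : CharZero) (b g : Series) (f : Fin ℓ → Series) (h h̄ : Series)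
      (hb : Homog 0 b) (hg : Homog 0 g) (hf : ∀ i → Homog 1 (f i))
      (b0≉0 : ¬ (b 0 ≈ 0#)) (g0≉0 : ¬ (g 0 ≈ 0#)) (f1≉0 : ∀ i → ¬ (f i 1 ≈ 0#))
      (h0≈0 : h 0 ≈ 0#) (h^ℓ≋Πf : pow h ℓ ≋ Π ℓ f)
      (h̄0≈0 : h̄ 0 ≈ 0#) (h∘h̄≋X : h ∘ₛ h̄ ≋ X) (h̄∘h≋X : h̄ ∘ₛ h ≋ X) where

      open CompositionalInverse h h̄ h0≈0 h̄0≈0 h̄∘h≋X

      f0≈0 : ∀ i → f i 0 ≈ 0#
      f0≈0 i = Homog-1-at-0 (hf i)

      ĥ : Series
      ĥ = shift h
      η : Series
      η = shift h̄
      γ : Series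
      γ = g ∘ₛ h̄

      φ : Fin ℓ → Series
      φ i = shift (f i ∘ₛ h̄)

      ĥ^ℓ≋Πf̂ : pow ĥ ℓ ≋ Π ℓ (λ i → shift (f i))
      ĥ^ℓ≋Πf̂ = shift-pow-Π ℓ {h} {f} h0≈0 f0≈0 h^ℓ≋Πf

      ĥ≉0 : ¬ (ĥ 0 ≈ 0#)
      ĥ≉0 = x*y≉0⇒x≉0 (λ ĥ^ℓ0≈0 → Π-≉0 ℓ (λ i → shift (f i)) f1≉0 (trans (sym (ĥ^ℓ≋Πf̂ 0)) ĥ^ℓ0≈0))

      Homog-h : Homog 1 h
      Homog-h = Homog-cong (≋.sym (X⊛-shift h h0≈0)) (Homog-⊛ Homog-X (Homog-root charZero (suc m) Πf̂-Homog ĥ^ℓ≋Πf̂ ĥ≉0))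
        where
        Πf̂-Homog : Homog 0 (Π ℓ (λ i → shift (f i)))
        Πf̂-Homog = Homog-≡ (sum-replicate-zero ℓ) (Homog-Π ℓ (λ i → Homog-shift (hf i)))

      Homog-h̄ : Homog 1 h̄
      Homog-h̄ = Homog-∘⁻¹ Homog-h h0≈0 h̄0≈0 h∘h̄≋X (Homog-cong (≋.sym h̄∘h≋X) Homog-X)

      Δ : Series
      Δ = const (b 0) ⊖ (b ∘ₛ h̄)
      N : Series
      N = (f last ∘ₛ h̄) ⊛ Δ
      D : Series
      D = b 0 • (h̄ ⊛ γ)
      T : Series
      T = N ÷ₜ D

      Bᴱ : Series
      Bᴱ = const (b 0 ⁻¹) ⊕ T

      Gᴱ : Series
      Gᴱ = inv γ

      Pᴱ : Fin ℓ → Series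
      Pᴱ i = (X ⊛ h̄) ÷ₜ (f i ∘ₛ h̄)

      E : Matrix
      E = MAR m Bᴱ Gᴱ Pᴱ

      η≉0 : ¬ (η 0 ≈ 0#)
      η≉0 η0≈0 = 1≉0 (trans (sym (shift-inverse 0)) (trans (*-cong refl (trans (∘-at-0 η h) η0≈0)) (zeroʳ _)))

      γ≉0 : ¬ (γ 0 ≈ 0#)
      γ≉0 γ0≈0 = g0≉0 (trans (sym (∘-at-0 g h̄)) γ0≈0)

      f∘h̄≋X⊛φ : ∀ i → f i ∘ₛ h̄ ≋ X ⊛ φ i
      f∘h̄≋X⊛φ i = X⊛-shift (f i ∘ₛ h̄) (trans (∘-at-0 (f i) h̄) (f0≈0 i))

      Πφ≋1 : Π ℓ φ ≋ const 1#
      Πφ≋1 = pow-X⊛-cancel ℓ (begin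
        pow X ℓ ⊛ Π ℓ φ              ≈⟨ ⊛-cong (Π-const ℓ X) (≋.refl {Π ℓ φ}) ⟨
        Π ℓ (λ _ → X) ⊛ Π ℓ φ        ≈⟨ Π-distrib-⊛ ℓ (λ _ → X) φ ⟨
        Π ℓ (λ i → X ⊛ φ i)          ≈⟨ Π-cong ℓ f∘h̄≋X⊛φ ⟨
        Π ℓ (λ i → f i ∘ₛ h̄)         ≈⟨ ∘-homo-Π ℓ f h̄ h̄0≈0 ⟨
        Π ℓ f ∘ₛ h̄                   ≈⟨ ∘-congˡ h̄ h^ℓ≋Πf ⟨
        pow h ℓ ∘ₛ h̄                 ≈⟨ ∘-homo-pow h h̄ ℓ h̄0≈0 ⟩
        pow (h ∘ₛ h̄) ℓ               ≈⟨ pow-cong ℓ h∘h̄≋X ⟩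
        pow X ℓ                      ≈⟨ ⊛-identityʳ (pow X ℓ) ⟨
        pow X ℓ ⊛ const 1#           ∎)
        where open ≋-Reasoning

      φ≉0 : ∀ i → ¬ (φ i 0 ≈ 0#)
      φ≉0 = Π-≉0⇒≉0 ℓ φ (λ Πφ0≈0 → 1≉0 (trans (sym (Πφ≋1 0)) Πφ0≈0))

      Pᴱ≋ : ∀ i → Pᴱ i ≋ h̄ ⊛ inv (φ i)
      Pᴱ≋ i = ⊛-cong (shift-X⊛ h̄) (≋.refl {inv (φ i)})

      shift-Pᴱ : ∀ i → shift (Pᴱ i) ≋ η ⊛ inv (φ i)
      shift-Pᴱ i = ≋.trans (shift-cong (≋.trans (Pᴱ≋ i) (≋.trans (⊛-cong (X⊛-shift h̄ h̄0≈0) (≋.refl {inv (φ i)}))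
                                                                    (⊛-assoc X η (inv (φ i))))))
                           (shift-X⊛ (η ⊛ inv (φ i)))

      h̄^ℓ≋ΠPᴱ : pow h̄ ℓ ≋ Π ℓ Pᴱ
      h̄^ℓ≋ΠPᴱ = ≋.sym (begin
        Π ℓ Pᴱ                              ≈⟨ Π-cong ℓ Pᴱ≋ ⟩
        Π ℓ (λ i → h̄ ⊛ inv (φ i))           ≈⟨ Π-distrib-⊛ ℓ (λ _ → h̄) (λ i → inv (φ i)) ⟩
        Π ℓ (λ _ → h̄) ⊛ Π ℓ (λ i → inv (φ i)) ≈⟨ ⊛-cong (Π-const ℓ h̄) Π-inv-φ ⟩
        pow h̄ ℓ ⊛ const 1#                  ≈⟨ ⊛-identityʳ (pow h̄ ℓ) ⟩
        pow h̄ ℓ                             ∎)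
        where
        open ≋-Reasoning
        Π-inv-φ : Π ℓ (λ i → inv (φ i)) ≋ const 1#
        Π-inv-φ = begin
          Π ℓ (λ i → inv (φ i))                    ≈⟨ ⊛-identityˡ _ ⟨
          const 1# ⊛ Π ℓ (λ i → inv (φ i))         ≈⟨ ⊛-cong Πφ≋1 (≋.refl {Π ℓ (λ i → inv (φ i))}) ⟨
          Π ℓ φ ⊛ Π ℓ (λ i → inv (φ i))            ≈⟨ Π-distrib-⊛ ℓ φ (λ i → inv (φ i)) ⟨
          Π ℓ (λ i → φ i ⊛ inv (φ i))              ≈⟨ Π-cong ℓ (λ i → inv-inverseʳ (φ i) (φ≉0 i)) ⟩
          Π ℓ (λ _ → const 1#)                     ≈⟨ ≋.trans (Π-const ℓ (const 1#)) (pow-one ℓ) ⟩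
          const 1#                                 ∎

      Homog-Bᴱ : Homog 0 Bᴱ
      Homog-Bᴱ = Homog-⊕ (Homog-const _) (Homog-÷ₜ hN hDn)
        where
        hN : Homog 1 N
        hN = Homog-⊛ (Homog-∘ Homog-h̄ (hf last)) (Homog-⊖ (Homog-const (b 0)) (Homog-∘ Homog-h̄ hb))
        hDn : Homog 1 D
        hDn = Homog-• (b 0) (Homog-⊛ Homog-h̄ (Homog-∘ Homog-h̄ hg))

      Homog-Gᴱ : Homog 0 Gᴱ
      Homog-Gᴱ = Homog-inv (Homog-∘ Homog-h̄ hg)

      Homog-Pᴱ : ∀ i → Homog 1 (Pᴱ i)
      Homog-Pᴱ i = Homog-÷ₜ (Homog-⊛ Homog-X Homog-h̄) (Homog-∘ Homog-h̄ (hf i))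

      Δ-at-0 : Δ 0 ≈ 0#
      Δ-at-0 = trans (+-cong refl (-‿cong (∘-at-0 b h̄))) (-‿inverseʳ (b 0))

      shift-N : shift N ≋ φ last ⊛ Δ
      shift-N = ≋.trans (shift-cong (≋.trans (⊛-cong (f∘h̄≋X⊛φ last) (≋.refl {Δ})) (⊛-assoc X (φ last) Δ)))
                        (shift-X⊛ (φ last ⊛ Δ))

      shift-D : shift D ≋ const (b 0) ⊛ (η ⊛ γ)
      shift-D = ≋.trans (shift-cong Dn≋) (shift-X⊛ (const (b 0) ⊛ (η ⊛ γ)))
        where
        open ≋-Reasoning
        open S-Solver using (solve; _:=_; _:*_)
        Dn≋ : D ≋ X ⊛ (const (b 0) ⊛ (η ⊛ γ))
        Dn≋ = begin
          b 0 • (h̄ ⊛ γ)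
            ≈⟨ const-⊛ (b 0) (h̄ ⊛ γ) ⟨
          const (b 0) ⊛ (h̄ ⊛ γ)
            ≈⟨ ⊛-cong (≋.refl {const (b 0)}) (⊛-cong (X⊛-shift h̄ h̄0≈0) (≋.refl {γ})) ⟩
          const (b 0) ⊛ ((X ⊛ η) ⊛ γ)
            ≈⟨ solve 4 (λ c x e g → c :* ((x :* e) :* g) := x :* (c :* (e :* g))) ≋.refl (const (b 0)) X η γ ⟩
          X ⊛ (const (b 0) ⊛ (η ⊛ γ))      ∎

      shift-D≉0 : ¬ (shift D 0 ≈ 0#)
      shift-D≉0 Dn1≈0 = x*y≉0 b0≉0 (x*y≉0 η≉0 γ≉0) (trans (sym (shift-D 0)) Dn1≈0)

      Bᴱ-at-0 : Bᴱ 0 ≈ b 0 ⁻¹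
      Bᴱ-at-0 = trans (+-cong refl T-at-0) (+-identityʳ _)
        where
        T-at-0 : T 0 ≈ 0#
        T-at-0 = trans (*-cong (trans (shift-N 0) (trans (*-cong refl Δ-at-0) (zeroʳ _))) refl) (zeroˡ _)

      module M⊗E where
        open Decomposition b g f h h0≈0 ĥ≉0 f0≈0 h^ℓ≋Πf public
        open Product Bᴱ Gᴱ Pᴱ Homog-Bᴱ Homog-Gᴱ Homog-Pᴱ public

      M⊗E-B′ : M⊗E.B′ ≋ const 1#
      M⊗E-B′ = begin
        (Bᴱ 0 • b) ⊕ ((X ⊛ g) ÷ₜ f last) ⊛ ((Bᴱ ∘ₛ h) ⊖ const (Bᴱ 0))
          ≈⟨ ⊕-cong (λ n → *-cong Bᴱ-at-0 refl) (⊛-cong (≋.refl {(X ⊛ g) ÷ₜ f last}) Bᴱ∘h-Bᴱ0) ⟩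
        (b 0 ⁻¹ • b) ⊕ ((X ⊛ g) ÷ₜ f last) ⊛ (T ∘ₛ h)
          ≈⟨ ⊕-cong (≋.refl {b 0 ⁻¹ • b}) lower-part ⟩
        (b 0 ⁻¹ • b) ⊕ b 0 ⁻¹ • (const (b 0) ⊖ b)
          ≈⟨ (λ n → trans (sym (distribˡ _ _ _)) (*-cong refl (x+[y-x]≈y (b n) (const (b 0) n)))) ⟩
        b 0 ⁻¹ • const (b 0)
          ≈⟨ b0⁻¹b0≈1 ⟩
        const 1# ∎
        where
        open ≋-Reasoning
        open S-Solver using (solve; _:=_; _:*_)
        f̂ : Series
        f̂ = shift (f last)
        Y : Series
        Y = inv (shift D) ∘ₛ h
        b0⁻¹b0≈1 : b 0 ⁻¹ • const (b 0) ≋ const 1#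
        b0⁻¹b0≈1 zero    = trans (*-comm _ _) (⁻¹-inverse (b 0) b0≉0)
        b0⁻¹b0≈1 (suc n) = zeroʳ _
        Bᴱ∘h-Bᴱ0 : (Bᴱ ∘ₛ h) ⊖ const (Bᴱ 0) ≋ T ∘ₛ h
        Bᴱ∘h-Bᴱ0 n = trans (⊖-cong (≋.trans (∘-homo-⊕ (const (b 0 ⁻¹)) T h) (⊕-cong (const-∘ (b 0 ⁻¹) h) (≋.refl {T ∘ₛ h})))
                                   (const-cong Bᴱ-at-0) n)
                           (cancel n)
          where
          cancel : (const (b 0 ⁻¹) ⊕ T ∘ₛ h) ⊖ const (b 0 ⁻¹) ≋ T ∘ₛ h
          cancel zero    = trans (+-cong (+-comm _ _) refl)
                             (trans (+-assoc _ _ _) (trans (+-cong refl (-‿inverseʳ _)) (+-identityʳ _)))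
          cancel (suc n) = trans (+-cong (+-identityˡ _) -0#≈0#) (+-identityʳ _)
        Δ∘h : Δ ∘ₛ h ≋ const (b 0) ⊖ b
        Δ∘h = ≋.trans (∘-homo-⊖ (const (b 0)) (b ∘ₛ h̄) h) (⊖-cong (const-∘ (b 0) h) (∘-cancel b))
        T∘h : T ∘ₛ h ≋ (φ last ∘ₛ h) ⊛ (Δ ∘ₛ h) ⊛ Y
        T∘h = ≋.trans (∘-congˡ h (⊛-cong shift-N (≋.refl {inv (shift D)})))
                (≋.trans (∘-homo-⊛ (φ last ⊛ Δ) (inv (shift D)) h h0≈0)
                         (⊛-cong (∘-homo-⊛ (φ last) Δ h h0≈0) (≋.refl {Y})))
        ηgY : ((η ∘ₛ h) ⊛ g) ⊛ Y ≋ const (b 0 ⁻¹)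
        ηgY = ≋.trans (inv-unique (const (b 0)) _ b0≉0 b0ηgY) (inv-const (b 0) b0≉0)
          where
          b0ηgY : const (b 0) ⊛ (((η ∘ₛ h) ⊛ g) ⊛ Y) ≋ const 1#
          b0ηgY = begin
            const (b 0) ⊛ (((η ∘ₛ h) ⊛ g) ⊛ Y)   ≈⟨ ⊛-assoc (const (b 0)) ((η ∘ₛ h) ⊛ g) Y ⟨
            (const (b 0) ⊛ ((η ∘ₛ h) ⊛ g)) ⊛ Y   ≈⟨ ⊛-cong shift-D∘h (≋.refl {Y}) ⟨
            (shift D ∘ₛ h) ⊛ Y                  ≈⟨ ∘-inverseʳ (shift D) h shift-D≉0 h0≈0 ⟩
            const 1#                             ∎
            where
            shift-D∘h : shift D ∘ₛ h ≋ const (b 0) ⊛ ((η ∘ₛ h) ⊛ g)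
            shift-D∘h = ≋.trans (∘-congˡ h shift-D) (≋.trans (∘-homo-⊛ (const (b 0)) (η ⊛ γ) h h0≈0)
                           (⊛-cong (const-∘ (b 0) h) (≋.trans (∘-homo-⊛ η γ h h0≈0)
                               (⊛-cong (≋.refl {η ∘ₛ h}) (∘-cancel g)))))
        lower-part : ((X ⊛ g) ÷ₜ f last) ⊛ (T ∘ₛ h) ≋ b 0 ⁻¹ • (const (b 0) ⊖ b)
        lower-part = begin
          (shift (X ⊛ g) ⊛ inv f̂) ⊛ (T ∘ₛ h)
            ≈⟨ ⊛-cong (⊛-cong (shift-X⊛ g) (≋.refl {inv f̂})) T∘h ⟩
          (g ⊛ inv f̂) ⊛ ((φ last ∘ₛ h) ⊛ (Δ ∘ₛ h) ⊛ Y)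
            ≈⟨ ⊛-identityʳ-≋ _ shift-inverse ⟨
          ((g ⊛ inv f̂) ⊛ ((φ last ∘ₛ h) ⊛ (Δ ∘ₛ h) ⊛ Y)) ⊛ (ĥ ⊛ (η ∘ₛ h))
            ≈⟨ solve 7 (λ g i p d y a e → ((g :* i) :* (p :* d :* y)) :* (a :* e) := ((a :* p) :* i) :* ((e :* g) :* y) :* d)
                       ≋.refl g (inv f̂) (φ last ∘ₛ h) (Δ ∘ₛ h) Y ĥ (η ∘ₛ h) ⟩
          ((ĥ ⊛ (φ last ∘ₛ h)) ⊛ inv f̂) ⊛ (((η ∘ₛ h) ⊛ g) ⊛ Y) ⊛ (Δ ∘ₛ h)
            ≈⟨ ⊛-cong (⊛-cong (⊛-cong (shift-∘-cancel (f last) (f0≈0 last)) (≋.refl {inv f̂})) ηgY) Δ∘h ⟩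
          (f̂ ⊛ inv f̂) ⊛ const (b 0 ⁻¹) ⊛ (const (b 0) ⊖ b)
            ≈⟨ ⊛-cong (≋.trans (⊛-cong (inv-inverseʳ f̂ (f1≉0 last)) (≋.refl {const (b 0 ⁻¹)})) (⊛-identityˡ _))
                      (≋.refl {const (b 0) ⊖ b}) ⟩
          const (b 0 ⁻¹) ⊛ (const (b 0) ⊖ b)
            ≈⟨ const-⊛ (b 0 ⁻¹) (const (b 0) ⊖ b) ⟩
          b 0 ⁻¹ • (const (b 0) ⊖ b) ∎

      M⊗E-G′ : M⊗E.G′ ≋ const 1#
      M⊗E-G′ = ≋.trans (⊛-cong (≋.sym (∘-cancel g)) (≋.refl {Gᴱ ∘ₛ h})) (∘-inverseʳ γ h γ≉0 h0≈0)

      M⊗E-F′ : ∀ i → M⊗E.F′ i ≋ X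
      M⊗E-F′ i = begin
        (shift (f i) ⊛ inv ĥ) ⊛ (Pᴱ i ∘ₛ h)
          ≈⟨ ⊛-cong (⊛-cong (≋.sym (shift-∘-cancel (f i) (f0≈0 i))) (≋.refl {inv ĥ})) Pᴱ∘h ⟩
        ((ĥ ⊛ (φ i ∘ₛ h)) ⊛ inv ĥ) ⊛ (X ⊛ (inv (φ i) ∘ₛ h))
          ≈⟨ solve 5 (λ a p i x q → ((a :* p) :* i) :* (x :* q) := x :* ((a :* i) :* (p :* q))) ≋.refl ĥ (φ i ∘ₛ h)
               (inv ĥ) X (inv (φ i) ∘ₛ h) ⟩
        X ⊛ ((ĥ ⊛ inv ĥ) ⊛ ((φ i ∘ₛ h) ⊛ (inv (φ i) ∘ₛ h)))
          ≈⟨ ⊛-identityʳ-≋ X (≋.trans (⊛-cong (inv-inverseʳ ĥ ĥ≉0) (∘-inverseʳ (φ i) h (φ≉0 i) h0≈0))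
               (⊛-identityˡ (const 1#))) ⟩
        X ∎
        where
        open ≋-Reasoning
        open S-Solver using (solve; _:=_; _:*_)
        Pᴱ∘h : Pᴱ i ∘ₛ h ≋ X ⊛ (inv (φ i) ∘ₛ h)
        Pᴱ∘h = ≋.trans (∘-congˡ h (Pᴱ≋ i)) (≋.trans (∘-homo-⊛ h̄ (inv (φ i)) h h0≈0)
            (⊛-cong h̄∘h≋X (≋.refl {inv (φ i) ∘ₛ h})))

      M⊗E≋Id : MAR m b g f ⊗ E ≋ᴹ Id
      M⊗E≋Id n k = trans (M⊗E.MAR-⊗ n k) (MAR-Id M⊗E-B′ M⊗E-G′ M⊗E-F′ n k)

      module E⊗M where
        open Decomposition Bᴱ Gᴱ Pᴱ h̄ h̄0≈0 η≉0 (λ i → Homog-1-at-0 (Homog-Pᴱ i)) h̄^ℓ≋ΠPᴱ public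
        open Product b g f hb hg hf public

      E⊗M-B′ : E⊗M.B′ ≋ const 1#
      E⊗M-B′ = begin
        (b 0 • Bᴱ) ⊕ ((X ⊛ Gᴱ) ÷ₜ Pᴱ last) ⊛ ((b ∘ₛ h̄) ⊖ const (b 0))
          ≈⟨ ⊕-cong b0•Bᴱ (⊛-cong ratio (≋.refl {(b ∘ₛ h̄) ⊖ const (b 0)})) ⟩
        (const 1# ⊕ R ⊛ Δ) ⊕ R ⊛ ((b ∘ₛ h̄) ⊖ const (b 0))
          ≈⟨ solve 4 (λ o r d e → (o :+ r :* d) :+ r :* e := o :+ r :* (d :+ e)) ≋.refl (const 1#) R Δ
               ((b ∘ₛ h̄) ⊖ const (b 0)) ⟩
        const 1# ⊕ R ⊛ (Δ ⊕ ((b ∘ₛ h̄) ⊖ const (b 0)))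
          ≈⟨ ⊕-cong (≋.refl {const 1#}) (≋.trans (⊛-cong (≋.refl {R}) Δ-cancel) (≋.trans (⊛-comm R 𝟘) (𝟘-⊛ R))) ⟩
        const 1# ⊕ 𝟘
          ≈⟨ (λ n → +-identityʳ _) ⟩
        const 1# ∎
        where
        open ≋-Reasoning
        open S-Solver using (solve; _:=_; _:+_; _:*_)
        R : Series
        R = inv γ ⊛ (inv η ⊛ φ last)
        Δ-cancel : Δ ⊕ ((b ∘ₛ h̄) ⊖ const (b 0)) ≋ 𝟘
        Δ-cancel n = trans (+-assoc _ _ _) (trans (+-cong refl (trans (sym (+-assoc _ _ _))
          (trans (+-cong (-‿inverseˡ _) refl) (+-identityˡ _)))) (-‿inverseʳ _))
        ratio : (X ⊛ Gᴱ) ÷ₜ Pᴱ last ≋ R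
        ratio = ⊛-cong (shift-X⊛ Gᴱ) (begin
          inv (shift (Pᴱ last))
            ≈⟨ inv-cong (λ z → x*y≉0 η≉0 (inv-≉0 (φ last) (φ≉0 last)) (trans (sym (shift-Pᴱ last 0)) z)) (shift-Pᴱ last) ⟩
          inv (η ⊛ inv (φ last))
            ≈⟨ inv-distrib-⊛ η (inv (φ last)) η≉0 (inv-≉0 (φ last) (φ≉0 last)) ⟩
          inv η ⊛ inv (inv (φ last))
            ≈⟨ ⊛-cong (≋.refl {inv η}) (inv-involutive (φ last) (φ≉0 last)) ⟩
          inv η ⊛ φ last                   ∎)
        inv-shift-D : inv (shift D) ≋ const (b 0 ⁻¹) ⊛ (inv η ⊛ inv γ)
        inv-shift-D = begin
          inv (shift D)
            ≈⟨ inv-cong shift-D≉0 shift-D ⟩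
          inv (const (b 0) ⊛ (η ⊛ γ))
            ≈⟨ inv-distrib-⊛ (const (b 0)) (η ⊛ γ) b0≉0 (x*y≉0 η≉0 γ≉0) ⟩
          inv (const (b 0)) ⊛ inv (η ⊛ γ)
            ≈⟨ ⊛-cong (inv-const (b 0) b0≉0) (inv-distrib-⊛ η γ η≉0 γ≉0) ⟩
          const (b 0 ⁻¹) ⊛ (inv η ⊛ inv γ)            ∎
        b0•Bᴱ : b 0 • Bᴱ ≋ const 1# ⊕ R ⊛ Δ
        b0•Bᴱ = begin
          b 0 • Bᴱ
            ≈⟨ (λ n → distribˡ (b 0) _ _) ⟩
          b 0 • const (b 0 ⁻¹) ⊕ b 0 • T
            ≈⟨ ⊕-cong (≋.sym b0b0⁻¹) (const-⊛ (b 0) T) ⟨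
          const 1# ⊕ const (b 0) ⊛ T
            ≈⟨ ⊕-cong (≋.refl {const 1#}) (⊛-cong (≋.refl {const (b 0)}) (⊛-cong shift-N inv-shift-D)) ⟩
          const 1# ⊕ const (b 0) ⊛ ((φ last ⊛ Δ) ⊛ (const (b 0 ⁻¹) ⊛ (inv η ⊛ inv γ)))
            ≈⟨ ⊕-cong (≋.refl {const 1#}) (solve 6 (λ c p d c′ e g → c :* ((p :* d) :* (c′ :* (e :* g))) :=
                 (c :* c′) :* ((g :* (e :* p)) :* d))
                                                   ≋.refl (const (b 0)) (φ last) Δ (const (b 0 ⁻¹)) (inv η) (inv γ)) ⟩
          const 1# ⊕ (const (b 0) ⊛ const (b 0 ⁻¹)) ⊛ (R ⊛ Δ)
            ≈⟨ ⊕-cong (≋.refl {const 1#}) (≋.trans (⊛-cong (const-⊛-const (b 0) (b 0 ⁻¹)) (≋.refl {R ⊛ Δ}))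
                                                  (≋.trans (⊛-cong (const-cong (⁻¹-inverse (b 0) b0≉0))
                                                      (≋.refl {R ⊛ Δ})) (⊛-identityˡ (R ⊛ Δ)))) ⟩
          const 1# ⊕ R ⊛ Δ                            ∎
          where
          b0b0⁻¹ : b 0 • const (b 0 ⁻¹) ≋ const 1#
          b0b0⁻¹ zero    = ⁻¹-inverse (b 0) b0≉0
          b0b0⁻¹ (suc n) = zeroʳ _

      E⊗M-G′ : E⊗M.G′ ≋ const 1#
      E⊗M-G′ = inv-inverseˡ γ γ≉0

      E⊗M-F′ : ∀ i → E⊗M.F′ i ≋ X
      E⊗M-F′ i = begin
        (shift (Pᴱ i) ⊛ inv η) ⊛ (f i ∘ₛ h̄)
          ≈⟨ ⊛-cong (⊛-cong (shift-Pᴱ i) (≋.refl {inv η})) (f∘h̄≋X⊛φ i) ⟩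
        ((η ⊛ inv (φ i)) ⊛ inv η) ⊛ (X ⊛ φ i)
          ≈⟨ solve 5 (λ e q i x p → ((e :* q) :* i) :* (x :* p) := x :* ((e :* i) :* (p :* q))) ≋.refl η (inv (φ i))
               (inv η) X (φ i) ⟩
        X ⊛ ((η ⊛ inv η) ⊛ (φ i ⊛ inv (φ i)))
          ≈⟨ ⊛-identityʳ-≋ X (≋.trans (⊛-cong (inv-inverseʳ η η≉0) (inv-inverseʳ (φ i) (φ≉0 i))) (⊛-identityˡ (const 1#))) ⟩
        X ∎
        where
        open ≋-Reasoning
        open S-Solver using (solve; _:=_; _:*_)

      E⊗M≋Id : E ⊗ MAR m b g f ≋ᴹ Id
      E⊗M≋Id n k = trans (E⊗M.MAR-⊗ n k) (MAR-Id E⊗M-B′ E⊗M-G′ E⊗M-F′ n k)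

theorem2p3 : ∀ {a r : Level} (K : Field a r) → let open FPS K in
  CharZero →
  (m : ℕ) → let ℓ = suc (suc m) in
  (b g c d : Series) (f p : Fin ℓ → Series) (h hbar : Series) →
  InPowℓ ℓ b → InPowℓ ℓ g → InPowℓ ℓ c → InPowℓ ℓ d →
  ¬ (b 0 ≈ 0#) → ¬ (g 0 ≈ 0#) → ¬ (c 0 ≈ 0#) → ¬ (d 0 ≈ 0#) →
  (∀ i → InTPowℓ ℓ (f i)) → (∀ i → ¬ (f i 1 ≈ 0#)) →
  (∀ i → InTPowℓ ℓ (p i)) → (∀ i → ¬ (p i 1 ≈ 0#)) →
  h 0 ≈ 0# → pow h ℓ ≋ Π ℓ f →
  hbar 0 ≈ 0# → h ∘ₛ hbar ≋ X → hbar ∘ₛ h ≋ X →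
  (MAR m b g f ⊗ MAR m c d p
     ≋ᴹ MAR m ((c 0 • b) ⊕ ((X ⊛ g) ÷ₜ f (fromℕ (suc m))) ⊛ ((c ∘ₛ h) ⊖ const (c 0)))
              (g ⊛ (d ∘ₛ h))
              (λ i → (f i ÷ₜ h) ⊛ (p i ∘ₛ h)))
  ×
  (let E = MAR m (const (b 0 ⁻¹)
                   ⊕ ((f (fromℕ (suc m)) ∘ₛ hbar) ⊛ (const (b 0) ⊖ (b ∘ₛ hbar)))
                       ÷ₜ (b 0 • (hbar ⊛ (g ∘ₛ hbar))))
                 (inv (g ∘ₛ hbar))
                 (λ i → (X ⊛ hbar) ÷ₜ (f i ∘ₛ hbar))
   in (MAR m b g f ⊗ E ≋ᴹ Id) × (E ⊗ MAR m b g f ≋ᴹ Id))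
-- The multiplication rule does not need c(0), d(0) ≠ 0 or [t]p_i ≠ 0.
theorem2p3 K charZero m b g c d f p h h̄ b∈ g∈ c∈ d∈ b0≉0 g0≉0 _ _ f∈ f1≉0 p∈ _
           h0≈0 h^ℓ≋Πf h̄0≈0 h∘h̄≋X h̄∘h≋X =
  Mul.MAR-⊗ , Inv.M⊗E≋Id , Inv.E⊗M≋Id
  where
  open PowerSeries K
  open Residues (suc (suc m)) using (Homog; InPowℓ⇒Homog; InTPowℓ⇒Homog)
  open Arrays m using (module Inverse; module Decomposition)
  hf : ∀ i → Homog 1 (f i)
  hf i = InTPowℓ⇒Homog (f∈ i)
  module Inv = Inverse charZero b g f h h̄ (InPowℓ⇒Homog b∈) (InPowℓ⇒Homog g∈) hf b0≉0 g0≉0 f1≉0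
                 h0≈0 h^ℓ≋Πf h̄0≈0 h∘h̄≋X h̄∘h≋X
  module Mul = Decomposition.Product b g f h h0≈0 Inv.ĥ≉0 Inv.f0≈0 h^ℓ≋Πf
                 c d p (InPowℓ⇒Homog c∈) (InPowℓ⇒Homog d∈) (λ i → InTPowℓ⇒Homog (p∈ i))
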